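{- Let $G$ be a simple graph on vertex set $[n]$ and let $\epsilon>0$. Let $H=(V_H,E_H)$ be the graph constructed from $G$ and $\epsilon$ as described in the context, let $\pi$ be a uniformly random bijection $E_H\to\{1,\dots,|E_H|\}$, and let $M_1(\pi)$ be the set of edges of $\mathrm{GMM}(H,\pi)$ with both endpoints in $V_1$. Then $$\tfrac12\mu(G)-\tfrac{\epsilon}{20}n\le\mathbb{E}_\pi|M_1(\pi)|\le\mu(G)\quad\text{and}\quad\nu(G)-\tfrac{\epsilon}{10}n\le2\,\mathbb{E}_\pi|M_1(\pi)|\le2\nu(G).$$
   Context: Construction of $H$: let $s:=10n/\epsilon$ (treated as an integer). $V_H=V_1\cup V_2\cup U_1\cup\dots\cup U_n$ where $V_1=\{1_1,\dots,n_1\}$ and $V_2=\{1_2,\dots,n_2\}$ are two copies of $[n]$ and each $U_v$ ($v\in[n]$) is a set of $s$ new vertices. Edges: for $v,i\in[n]$, $\{v_1,i_1\}\in E_H$ and $\{v_2,i_2\}\in E_H$ iff $\{v,i\}\in E(G)$; $\{v_1,i_2\}\in E_H$ iff $\{v,i\}\notin E(G)$ (in particular $\{v_1,v_2\}\in E_H$ for every $v$); and each vertex of $U_v$ is adjacent exactly to $v_2$. $\mathrm{GMM}(H,\pi)$ is the matching obtained by scanning the edges of $H$ in increasing $\pi$-rank and adding each edge whose endpoints are both currently unmatched. $\mu(G)$ is the maximum matching size and $\nu(G)$ the minimum vertex cover size of $G$. -}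

module Defs where

open import Data.Bool using (Bool; true; false; _∧_; not; if_then_else_)
open import Data.Nat using (ℕ; zero; suc; _+_; _*_; _≤_; _<ᵇ_)
open import Data.Fin using (Fin; toℕ)
open import Data.Fin.Subset using (Subset; _∈_; ∣_∣)
open import Data.List using (List; []; _∷_; _++_; map; concatMap; length; allFin)
open import Data.Nat.ListAction using (sum)
open import Data.List.Relation.Unary.All using (All)
open import Data.List.Relation.Unary.Unique.Propositional using (Unique)
open import Data.Product using (_×_; _,_; Σ; ∃)
open import Data.Sum using (_⊎_)
open import Data.Integer using (+_)
import Data.Integer as ℤ
open import Data.Rational using (ℚ; 0ℚ; _/_; _÷_; _<_; >-nonZero; ceiling)
open import Relation.Binary.PropositionalEquality using (_≡_; refl; cong)
open import Relation.Nullary using (Dec; yes; no; ¬_)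
import Data.Fin.Properties as FinP

record Graph (n : ℕ) : Set where
  field
    adj    : Fin n → Fin n → Bool
    sym    : ∀ i j → adj i j ≡ adj j i
    irrefl : ∀ i → adj i i ≡ false
open Graph public

endpoints : ∀ {A : Set} → List (A × A) → List A
endpoints = concatMap (λ { (a , b) → a ∷ b ∷ [] })

IsMatching : ∀ {n} → Graph n → List (Fin n × Fin n) → Set
IsMatching G M = All (λ { (i , j) → adj G i j ≡ true }) M × Unique (endpoints M)

IsMaxMatchingSize : ∀ {n} → Graph n → ℕ → Set
IsMaxMatchingSize G k =
  (Σ (List _) λ M → IsMatching G M × length M ≡ k) ×
  (∀ M → IsMatching G M → length M ≤ k)

IsVertexCover : ∀ {n} → Graph n → Subset n → Set
IsVertexCover G C = ∀ i j → adj G i j ≡ true → (i ∈ C) ⊎ (j ∈ C)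

IsMinVertexCoverSize : ∀ {n} → Graph n → ℕ → Set
IsMinVertexCoverSize {n} G k =
  (Σ (Subset n) λ C → IsVertexCover G C × ∣ C ∣ ≡ k) ×
  (∀ C → IsVertexCover G C → k ≤ ∣ C ∣)

-- The graph H (vertices V₁ ∪ V₂ ∪ U₁ ∪ … ∪ Uₙ, |U_v| = s)

data VH (n s : ℕ) : Set where
  v1 : Fin n → VH n s
  v2 : Fin n → VH n s
  u  : Fin n → Fin s → VH n s

module _ {n s : ℕ} where
  _≟V_ : (a b : VH n s) → Dec (a ≡ b)
  v1 i ≟V v1 j with i FinP.≟ j
  ... | yes refl = yes refl
  ... | no ne = no λ { refl → ne refl }
  v2 i ≟V v2 j with i FinP.≟ j
  ... | yes refl = yes refl
  ... | no ne = no λ { refl → ne refl }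
  u i k ≟V u j l with i FinP.≟ j | k FinP.≟ l
  ... | yes refl | yes refl = yes refl
  ... | no ne | _ = no λ { refl → ne refl }
  ... | _ | no ne = no λ { refl → ne refl }
  v1 _ ≟V v2 _ = no λ ()
  v1 _ ≟V u _ _ = no λ ()
  v2 _ ≟V v1 _ = no λ ()
  v2 _ ≟V u _ _ = no λ ()
  u _ _ ≟V v1 _ = no λ ()
  u _ _ ≟V v2 _ = no λ ()

  isV1 : VH n s → Bool
  isV1 (v1 _) = true
  isV1 _      = false

  _∈V?_ : VH n s → List (VH n s) → Bool
  a ∈V? [] = false
  a ∈V? (b ∷ bs) with a ≟V b
  ... | yes _ = true
  ... | no _  = a ∈V? bs

-- E_H, each edge listed exactly once
edgesH : ∀ {n} → Graph n → (s : ℕ) → List (VH n s × VH n s)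
edgesH {n} G s = E11 ++ E22 ++ E12 ++ EU
  where
  pairsIf : (Fin n → Fin n → Bool) → (Fin n → Fin n → VH n s × VH n s) → List (VH n s × VH n s)
  pairsIf P f = concatMap (λ i → concatMap (λ j → if P i j then f i j ∷ [] else []) (allFin n)) (allFin n)
  E11 = pairsIf (λ i j → adj G i j ∧ (toℕ i <ᵇ toℕ j)) (λ i j → v1 i , v1 j)
  E22 = pairsIf (λ i j → adj G i j ∧ (toℕ i <ᵇ toℕ j)) (λ i j → v2 i , v2 j)
  E12 = pairsIf (λ i j → not (adj G i j)) (λ i j → v1 i , v2 j)
  EU  = concatMap (λ v → map (λ k → v2 v , u v k) (allFin s)) (allFin n)

sOf : ℕ → (ε : ℚ) → 0ℚ < ε → ℕ
sOf n ε ε>0 = ℤ.∣ ceiling (((+ (10 * n)) / 1) ÷ ε) ∣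
  where instance _ = >-nonZero ε>0

-- Greedy maximal matching along an ordering of the edges
-- (the list σ lists the edges in increasing π-rank)

gmmAux : ∀ {n s} → List (VH n s × VH n s) → List (VH n s) → List (VH n s × VH n s)
gmmAux [] used = []
gmmAux ((a , b) ∷ es) used =
  if (a ∈V? used) Data.Bool.∨ (b ∈V? used)
  then gmmAux es used
  else (a , b) ∷ gmmAux es (a ∷ b ∷ used)

GMM : ∀ {n s} → List (VH n s × VH n s) → List (VH n s × VH n s)
GMM σ = gmmAux σ []

M1size : ∀ {n s} → List (VH n s × VH n s) → ℕ
M1size σ = length (Data.List.filterᵇ (λ { (a , b) → isV1 a ∧ isV1 b }) (GMM σ))

-- All orderings of a list (for a duplicate-free list: each ordering once,
-- i.e. these correspond bijectively to the bijections π : E → {1..|E|})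

insertions : ∀ {A : Set} → A → List A → List (List A)
insertions x [] = (x ∷ []) ∷ []
insertions x (y ∷ ys) = (x ∷ y ∷ ys) ∷ map (y ∷_) (insertions x ys)

orderings : ∀ {A : Set} → List A → List (List A)
orderings [] = [] ∷ []
orderings (x ∷ xs) = concatMap (insertions x) (orderings xs)

average : List ℕ → ℚ
average [] = 0ℚ
average (x ∷ xs) = (+ (x + sum xs)) / suc (length xs)

expectedM1 : ∀ {n} → Graph n → (s : ℕ) → ℚ
expectedM1 G s = average (map M1size (orderings (edgesH G s)))

-- For every ordering σ of E_H, the V₁V₁ edges of GMM(H, σ) project to a matching of G, so |M₁| ≤ μ ≤ ν.
-- Conversely, by maximality the vertices of V₁ covered by GMM(H, σ) form a vertex cover of G; each is
-- covered by a V₁V₁ edge (two per edge) or by a cross edge (v1 i , v2 j), so ν ≤ 2 |M₁| + #cross edges.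
-- The pendant vertices of U_j can only be matched to v2 j, so a cross edge (v1 i , v2 j) is chosen only
-- if it precedes the s pendant edges at v2 j; by symmetry this happens in a 1/(s + 1) fraction of the
-- orderings. With at most n² cross edges and s ≥ 10n/ε, the cross edges contribute at most εn/10 on average.

module Submission where

open import Defs hiding (sym)

-- The development lives in an anonymous module so that its ℕ operators are not in scope in the
-- statement, which uses the ℚ ones.
module _ where

  open import Data.Bool using (Bool; true; false; if_then_else_; _∧_; _∨_; not)
  open import Data.Bool.Properties using (∧-conicalˡ; ∨-conicalˡ; ∨-conicalʳ; T-≡)
  open import Data.Nat using (ℕ; suc; _+_; _*_; _≤_; _<_; z≤n; s≤s; _<ᵇ_)
  open import Data.Nat.Properties
  open import Data.Nat.Tactic.RingSolver using (solve-∀)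
  open import Algebra.Properties.CommutativeSemigroup +-commutativeSemigroup using (interchange)
  open import Data.Fin as Fin using (Fin; toℕ)
  import Data.Fin.Properties as Fin
  open import Data.Fin.Subset as Subset using (Subset; ∣_∣)
  open import Data.Vec as Vec using ([]; _∷_)
  import Data.Vec.Properties as Vecₚ
  open import Data.Nat.ListAction using (sum)
  open import Data.List using (List; []; _∷_; _++_; map; concatMap; length; allFin; filterᵇ)
  import Data.List.Properties as List
  open import Data.List.Membership.Propositional using (_∈_; _∉_; find; lose)
  open import Data.List.Membership.Propositional.Properties
    using (∈-++⁻; ∈-++⁺ˡ; ∈-++⁺ʳ; ∈-map⁻; ∈-map⁺; ∈-allFin; ∈-concatMap⁺; ∈-concatMap⁻; ∈-∃++; ∈-filter⁻; ∈-filter⁺)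
  open import Data.List.Relation.Unary.Any using (here; there)
  open import Data.List.Relation.Unary.All as All using (All; []; _∷_)
  open import Data.List.Relation.Unary.AllPairs using ([]; _∷_)
  open import Data.List.Relation.Unary.Unique.Propositional using (Unique)
  import Data.List.Relation.Unary.Unique.Propositional.Properties as Unique
  open import Data.List.Relation.Binary.Permutation.Propositional as Perm using (_↭_; ↭⇒↭ₛ)
  import Data.List.Relation.Binary.Permutation.Propositional.Properties as Perm
  import Data.List.Relation.Binary.Permutation.Setoid.Properties as PermSetoid
  open import Data.Product using (_×_; _,_; Σ; ∃; ∃₂; proj₁; proj₂)
  open import Data.Product.Properties using (≡-dec)
  open import Data.Unit using (⊤; tt)
  open import Function using (_∘_; Equivalence)
  open import Data.Sum using (_⊎_; inj₁; inj₂)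
  import Data.Sum
  open import Data.Integer as ℤ using (ℤ)
  import Data.Integer.Properties as ℤ
  import Data.Integer.DivMod as ℤ
  open import Data.Rational as ℚ using (ℚ; 0ℚ; _/_; ½)
  import Data.Rational.Properties as ℚ
  import Data.Rational.Unnormalised as ℚᵘ
  import Data.Rational.Unnormalised.Properties as ℚᵘ
  open import Data.Rational.Solver using (module +-*-Solver)
  open +-*-Solver using (solve; _:+_; _:-_; :-_; _:*_; _:=_; con)
  open import Data.Empty using (⊥; ⊥-elim)
  open import Relation.Nullary using (yes; no; ¬_; does)
  open import Relation.Nullary.Decidable using (dec-true; dec-false; T?)
  open import Relation.Binary.Definitions using (DecidableEquality; tri<; tri≈; tri>)
  open import Relation.Binary.PropositionalEquality
    using (_≡_; _≢_; refl; sym; trans; cong; cong₂; subst; subst₂; setoid; module ≡-Reasoning)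

  private
    variable
      A B : Set

  ∑ : (A → ℕ) → List A → ℕ
  ∑ f []       = 0
  ∑ f (x ∷ xs) = f x + ∑ f xs

  𝟙 : Bool → ℕ
  𝟙 true  = 1
  𝟙 false = 0

  ∑-++ : (f : A → ℕ) (xs ys : List A) → ∑ f (xs ++ ys) ≡ ∑ f xs + ∑ f ys
  ∑-++ f []       ys = refl
  ∑-++ f (x ∷ xs) ys = trans (cong (f x +_) (∑-++ f xs ys)) (sym (+-assoc (f x) _ _))

  ∑-concatMap : (f : B → ℕ) (g : A → List B) (xs : List A) →
                ∑ f (concatMap g xs) ≡ ∑ (λ x → ∑ f (g x)) xs
  ∑-concatMap f g []       = refl
  ∑-concatMap f g (x ∷ xs) =
    trans (∑-++ f (g x) (concatMap g xs)) (cong (∑ f (g x) +_) (∑-concatMap f g xs))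

  ∑-map : (f : B → ℕ) (g : A → B) (xs : List A) →
          ∑ f (map g xs) ≡ ∑ (λ x → f (g x)) xs
  ∑-map f g []       = refl
  ∑-map f g (x ∷ xs) = cong (f (g x) +_) (∑-map f g xs)

  ∑-cong : {f g : A → ℕ} (xs : List A) → (∀ {x} → x ∈ xs → f x ≡ g x) → ∑ f xs ≡ ∑ g xs
  ∑-cong []       eq = refl
  ∑-cong (x ∷ xs) eq = cong₂ _+_ (eq (here refl)) (∑-cong xs (λ p → eq (there p)))

  ∑-mono : {f g : A → ℕ} (xs : List A) → (∀ {x} → x ∈ xs → f x ≤ g x) → ∑ f xs ≤ ∑ g xs
  ∑-mono []       le = z≤n
  ∑-mono (x ∷ xs) le = +-mono-≤ (le (here refl)) (∑-mono xs (λ p → le (there p)))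

  ∑-+ : (f g : A → ℕ) (xs : List A) → ∑ (λ x → f x + g x) xs ≡ ∑ f xs + ∑ g xs
  ∑-+ f g []       = refl
  ∑-+ f g (x ∷ xs) =
    trans (cong (f x + g x +_) (∑-+ f g xs)) (interchange (f x) (g x) (∑ f xs) (∑ g xs))

  ∑-*ˡ : (c : ℕ) (f : A → ℕ) (xs : List A) → ∑ (λ x → c * f x) xs ≡ c * ∑ f xs
  ∑-*ˡ c f []       = sym (*-zeroʳ c)
  ∑-*ˡ c f (x ∷ xs) = trans (cong (c * f x +_) (∑-*ˡ c f xs)) (sym (*-distribˡ-+ c (f x) _))

  ∑-const : (k : ℕ) (xs : List A) → ∑ (λ _ → k) xs ≡ length xs * k
  ∑-const k []       = refl
  ∑-const k (x ∷ xs) = cong (k +_) (∑-const k xs)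

  ∑-swap : (f : A → B → ℕ) (xs : List A) (ys : List B) →
           ∑ (λ x → ∑ (f x) ys) xs ≡ ∑ (λ y → ∑ (λ x → f x y) xs) ys
  ∑-swap f []       ys = sym (trans (∑-const 0 ys) (*-zeroʳ (length ys)))
  ∑-swap f (x ∷ xs) ys =
    trans (cong (∑ (f x) ys +_) (∑-swap f xs ys)) (sym (∑-+ (f x) (λ y → ∑ (λ x → f x y) xs) ys))

  sum-map : (f : A → ℕ) (xs : List A) → sum (map f xs) ≡ ∑ f xs
  sum-map f []       = refl
  sum-map f (x ∷ xs) = cong (f x +_) (sum-map f xs)

  average-map : (f : A → ℕ) (xs : List A) {k : ℕ} → length xs ≡ suc k → average (map f xs) ≡ ℤ.+ ∑ f xs / suc k
  average-map f (x ∷ xs) refl = cong₂ (λ a b → ℤ.+ (f x + a) / suc b) (sum-map f xs) (List.length-map f xs)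

  length-concatMap : (f : A → List B) (xs : List A) → length (concatMap f xs) ≡ ∑ (length ∘ f) xs
  length-concatMap f []       = refl
  length-concatMap f (x ∷ xs) = trans (List.length-++ (f x)) (cong (length (f x) +_) (length-concatMap f xs))

  length-filterᵇ : (p : A → Bool) (xs : List A) → length (filterᵇ p xs) ≡ ∑ (λ x → 𝟙 (p x)) xs
  length-filterᵇ p []       = refl
  length-filterᵇ p (x ∷ xs) with p x
  ... | true  = cong suc (length-filterᵇ p xs)
  ... | false = length-filterᵇ p xs

  insertions-map : (f : A → B) (x : A) (ys : List A) →
                   insertions (f x) (map f ys) ≡ map (map f) (insertions x ys)
  insertions-map f x []       = refl
  insertions-map f x (y ∷ ys) = cong ((f x ∷ f y ∷ map f ys) ∷_) (begin
    map (f y ∷_) (insertions (f x) (map f ys))   ≡⟨ cong (map (f y ∷_)) (insertions-map f x ys) ⟩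
    map (f y ∷_) (map (map f) (insertions x ys)) ≡⟨ List.map-∘ (insertions x ys) ⟨
    map (map f ∘ (y ∷_)) (insertions x ys)       ≡⟨ List.map-∘ (insertions x ys) ⟩
    map (map f) (map (y ∷_) (insertions x ys))   ∎)
    where open ≡-Reasoning

  ∑-orderings-map : (f : A → A) (g : List A → ℕ) (xs : List A) →
                    ∑ g (orderings (map f xs)) ≡ ∑ (λ σ → g (map f σ)) (orderings xs)
  ∑-orderings-map f g []       = refl
  ∑-orderings-map f g (x ∷ xs) = begin
    ∑ g (concatMap (insertions (f x)) (orderings (map f xs)))
      ≡⟨ ∑-concatMap g (insertions (f x)) (orderings (map f xs)) ⟩
    ∑ (λ ys → ∑ g (insertions (f x) ys)) (orderings (map f xs))
      ≡⟨ ∑-orderings-map f _ xs ⟩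
    ∑ (λ ys → ∑ g (insertions (f x) (map f ys))) (orderings xs)
      ≡⟨ ∑-cong (orderings xs) (λ {ys} _ →
           trans (cong (∑ g) (insertions-map f x ys)) (∑-map g (map f) (insertions x ys))) ⟩
    ∑ (λ ys → ∑ (λ σ → g (map f σ)) (insertions x ys)) (orderings xs)
      ≡⟨ ∑-concatMap _ (insertions x) (orderings xs) ⟨
    ∑ (λ σ → g (map f σ)) (concatMap (insertions x) (orderings xs)) ∎
    where open ≡-Reasoning

  ∑-insertions² : A → A → (List A → ℕ) → List A → ℕ
  ∑-insertions² x y g ys = ∑ (λ zs → ∑ g (insertions x zs)) (insertions y ys)

  ∑-insertions²-∷ : (x y a : A) (as : List A) (g : List A → ℕ) →
    ∑-insertions² x y g (a ∷ as) ≡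
      (g (x ∷ y ∷ a ∷ as) + (g (y ∷ x ∷ a ∷ as) + ∑ (λ w → g (y ∷ a ∷ w)) (insertions x as)))
      + (∑ (λ w → g (x ∷ a ∷ w)) (insertions y as) + ∑-insertions² x y (λ w → g (a ∷ w)) as)
  ∑-insertions²-∷ x y a as g = cong₂ _+_
    (cong (λ t → g (x ∷ y ∷ a ∷ as) + (g (y ∷ x ∷ a ∷ as) + t))
      (trans (∑-map g (y ∷_) (map (a ∷_) (insertions x as))) (∑-map _ (a ∷_) (insertions x as))))
    (trans (∑-map (λ zs → ∑ g (insertions x zs)) (a ∷_) (insertions y as))
      (trans (∑-cong (insertions y as) (λ {zs} _ → cong (g (x ∷ a ∷ zs) +_) (∑-map g (a ∷_) (insertions x zs))))
        (∑-+ (λ zs → g (x ∷ a ∷ zs)) (λ zs → ∑ (λ w → g (a ∷ w)) (insertions x zs)) (insertions y as))))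

  ∑-insertions²-comm : (x y : A) (g : List A → ℕ) (ys : List A) →
                       ∑-insertions² x y g ys ≡ ∑-insertions² y x g ys
  ∑-insertions²-comm x y g []       = cong (_+ 0) (trans (cong (g (x ∷ y ∷ []) +_) (+-identityʳ _))
    (trans (+-comm (g (x ∷ y ∷ [])) _) (cong (g (y ∷ x ∷ []) +_) (sym (+-identityʳ _)))))
  ∑-insertions²-comm x y g (a ∷ as) = begin
    ∑-insertions² x y g (a ∷ as)
      ≡⟨ ∑-insertions²-∷ x y a as g ⟩
    (g (x ∷ y ∷ a ∷ as) + (g (y ∷ x ∷ a ∷ as) + ∑ (λ w → g (y ∷ a ∷ w)) (insertions x as)))
      + (∑ (λ w → g (x ∷ a ∷ w)) (insertions y as) + ∑-insertions² x y (λ w → g (a ∷ w)) as)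
      ≡⟨ cong (λ t → (g (x ∷ y ∷ a ∷ as) + (g (y ∷ x ∷ a ∷ as) + ∑ (λ w → g (y ∷ a ∷ w)) (insertions x as)))
                     + (∑ (λ w → g (x ∷ a ∷ w)) (insertions y as) + t))
              (∑-insertions²-comm x y (λ w → g (a ∷ w)) as) ⟩
    (g (x ∷ y ∷ a ∷ as) + (g (y ∷ x ∷ a ∷ as) + ∑ (λ w → g (y ∷ a ∷ w)) (insertions x as)))
      + (∑ (λ w → g (x ∷ a ∷ w)) (insertions y as) + ∑-insertions² y x (λ w → g (a ∷ w)) as)
      ≡⟨ rearrange (g (x ∷ y ∷ a ∷ as)) (g (y ∷ x ∷ a ∷ as)) (∑ (λ w → g (y ∷ a ∷ w)) (insertions x as))
                   (∑ (λ w → g (x ∷ a ∷ w)) (insertions y as)) (∑-insertions² y x (λ w → g (a ∷ w)) as) ⟩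
    (g (y ∷ x ∷ a ∷ as) + (g (x ∷ y ∷ a ∷ as) + ∑ (λ w → g (x ∷ a ∷ w)) (insertions y as)))
      + (∑ (λ w → g (y ∷ a ∷ w)) (insertions x as) + ∑-insertions² y x (λ w → g (a ∷ w)) as)
      ≡⟨ ∑-insertions²-∷ y x a as g ⟨
    ∑-insertions² y x g (a ∷ as) ∎
    where
    open ≡-Reasoning
    rearrange : ∀ p q r t i → (p + (q + r)) + (t + i) ≡ (q + (p + t)) + (r + i)
    rearrange = solve-∀

  ∑-orderings-↭ : {xs ys : List A} → xs ↭ ys → (g : List A → ℕ) → ∑ g (orderings xs) ≡ ∑ g (orderings ys)
  ∑-orderings-↭ Perm.refl g = refl
  ∑-orderings-↭ (Perm.prep {xs = xs} {ys = ys} x p) g = begin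
    ∑ g (concatMap (insertions x) (orderings xs))      ≡⟨ ∑-concatMap g (insertions x) (orderings xs) ⟩
    ∑ (λ zs → ∑ g (insertions x zs)) (orderings xs)    ≡⟨ ∑-orderings-↭ p (λ zs → ∑ g (insertions x zs)) ⟩
    ∑ (λ zs → ∑ g (insertions x zs)) (orderings ys)    ≡⟨ ∑-concatMap g (insertions x) (orderings ys) ⟨
    ∑ g (concatMap (insertions x) (orderings ys))      ∎
    where open ≡-Reasoning
  ∑-orderings-↭ (Perm.swap {xs = xs} {ys = ys} x y p) g = begin
    ∑ g (concatMap (insertions x) (concatMap (insertions y) (orderings xs)))
      ≡⟨ ∑-concatMap g (insertions x) (concatMap (insertions y) (orderings xs)) ⟩
    ∑ (λ zs → ∑ g (insertions x zs)) (concatMap (insertions y) (orderings xs))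
      ≡⟨ ∑-concatMap _ (insertions y) (orderings xs) ⟩
    ∑ (∑-insertions² x y g) (orderings xs)
      ≡⟨ ∑-orderings-↭ p (∑-insertions² x y g) ⟩
    ∑ (∑-insertions² x y g) (orderings ys)
      ≡⟨ ∑-cong (orderings ys) (λ {zs} _ → ∑-insertions²-comm x y g zs) ⟩
    ∑ (∑-insertions² y x g) (orderings ys)
      ≡⟨ ∑-concatMap _ (insertions x) (orderings ys) ⟨
    ∑ (λ zs → ∑ g (insertions y zs)) (concatMap (insertions x) (orderings ys))
      ≡⟨ ∑-concatMap g (insertions y) (concatMap (insertions x) (orderings ys)) ⟨
    ∑ g (concatMap (insertions y) (concatMap (insertions x) (orderings ys))) ∎
    where open ≡-Reasoning
  ∑-orderings-↭ (Perm.trans p q) g = trans (∑-orderings-↭ p g) (∑-orderings-↭ q g)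

  ∈-insertions⇒↭ : (x : A) (ys : List A) {zs : List A} → zs ∈ insertions x ys → zs ↭ x ∷ ys
  ∈-insertions⇒↭ x []       (here refl) = Perm.refl
  ∈-insertions⇒↭ x (y ∷ ys) (here refl) = Perm.refl
  ∈-insertions⇒↭ x (y ∷ ys) (there zs∈) with ∈-map⁻ (y ∷_) zs∈
  ... | zs′ , zs′∈ , refl = Perm.trans (Perm.prep y (∈-insertions⇒↭ x ys zs′∈)) (Perm.swap y x Perm.refl)

  ∈-orderings⇒↭ : (xs : List A) {σ : List A} → σ ∈ orderings xs → σ ↭ xs
  ∈-orderings⇒↭ []       (here refl) = Perm.refl
  ∈-orderings⇒↭ (x ∷ xs) σ∈ with find (∈-concatMap⁻ (insertions x) {xs = orderings xs} σ∈)
  ... | ys , ys∈ , σ∈′ = Perm.trans (∈-insertions⇒↭ x ys σ∈′) (Perm.prep x (∈-orderings⇒↭ xs ys∈))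

  orderings-nonEmpty : (xs : List A) → ∃₂ λ σ rest → orderings xs ≡ σ ∷ rest
  orderings-nonEmpty []       = [] , [] , refl
  orderings-nonEmpty (x ∷ xs) with orderings-nonEmpty xs
  ... | σ , rest , eq rewrite eq with σ
  ... | []     = x ∷ [] , _ , refl
  ... | y ∷ ys = x ∷ y ∷ ys , _ , refl

  Unique-resp-↭ : {xs ys : List A} → xs ↭ ys → Unique xs → Unique ys
  Unique-resp-↭ p = PermSetoid.Unique-resp-↭ (setoid _) (↭⇒↭ₛ p)

  -- The exchange argument

  module FirstAmong {A : Set} (_≟_ : DecidableEquality A) where
    open import Data.List.Membership.DecPropositional _≟_ using (_∈?_)

    isFirstAmong : A → List A → List A → Bool
    isFirstAmong e C []       = false
    isFirstAmong e C (x ∷ xs) = if does (x ∈? C) then does (x ≟ e) else isFirstAmong e C xs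

    isFirstAmong-∈ : {e x : A} (C xs : List A) → x ∈ C → isFirstAmong e C (x ∷ xs) ≡ does (x ≟ e)
    isFirstAmong-∈ {x = x} C xs x∈C rewrite dec-true (x ∈? C) x∈C = refl

    isFirstAmong-∉ : {e x : A} (C xs : List A) → x ∉ C → isFirstAmong e C (x ∷ xs) ≡ isFirstAmong e C xs
    isFirstAmong-∉ {x = x} C xs x∉C rewrite dec-false (x ∈? C) x∉C = refl

    #firstAmong : A → List A → List A → ℕ
    #firstAmong e C L = ∑ (λ σ → 𝟙 (isFirstAmong e C σ)) (orderings L)

    ∑-≟-Unique : (x : A) (C : List A) → Unique C → ∑ (λ c → 𝟙 (does (x ≟ c))) C ≤ 1
    ∑-≟-Unique x []       _           = z≤n
    ∑-≟-Unique x (c ∷ C) (c∉C ∷ uC) with x ≟ c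
    ... | yes refl = s≤s (≤-reflexive (absent C (λ x∈C → All.lookup c∉C x∈C refl)))
      where
      absent : (D : List A) → x ∉ D → ∑ (λ d → 𝟙 (does (x ≟ d))) D ≡ 0
      absent []      _   = refl
      absent (d ∷ D) x∉D with x ≟ d
      ... | yes refl = ⊥-elim (x∉D (here refl))
      ... | no _     = absent D (λ p → x∉D (there p))
    ... | no _     = ∑-≟-Unique x C uC

    ∑-isFirstAmong≤1 : (C : List A) → Unique C → (σ : List A) → ∑ (λ c → 𝟙 (isFirstAmong c C σ)) C ≤ 1
    ∑-isFirstAmong≤1 C uC []       = ≤-trans (≤-reflexive (trans (∑-const 0 C) (*-zeroʳ (length C)))) z≤n
    ∑-isFirstAmong≤1 C uC (x ∷ xs) with x ∈? C
    ... | yes _ = ∑-≟-Unique x C uC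
    ... | no _  = ∑-isFirstAmong≤1 C uC xs

    module _ (e c : A) where

      transpose : A → A
      transpose x = if does (x ≟ e) then c else (if does (x ≟ c) then e else x)

      isFirstAmong-transpose : (C : List A) → e ∈ C → c ∈ C → (σ : List A) →
                               isFirstAmong c C (map transpose σ) ≡ isFirstAmong e C σ
      isFirstAmong-transpose C e∈ c∈ []       = refl
      isFirstAmong-transpose C e∈ c∈ (x ∷ xs) with x ≟ e
      ... | yes refl rewrite dec-true (c ∈? C) c∈ | dec-true (x ∈? C) e∈ | dec-true (c ≟ c) refl = refl
      ... | no x≢e with x ≟ c
      ... | yes refl rewrite dec-true (e ∈? C) e∈ | dec-true (x ∈? C) c∈
                           | dec-false (e ≟ x) (λ eq → x≢e (sym eq)) = refl
      ... | no x≢c with x ∈? C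
      ... | yes _ rewrite dec-false (x ≟ c) x≢c = refl
      ... | no _  = isFirstAmong-transpose C e∈ c∈ xs

      transpose-swaps : c ≢ e → (R : List A) → e ∉ R → c ∉ R → map transpose (e ∷ c ∷ R) ≡ c ∷ e ∷ R
      transpose-swaps c≢e R e∉R c∉R rewrite dec-true (e ≟ e) refl | dec-false (c ≟ e) c≢e | dec-true (c ≟ c) refl =
        cong (λ R′ → c ∷ e ∷ R′) (fixes R e∉R c∉R)
        where
        fixes : (R : List A) → e ∉ R → c ∉ R → map transpose R ≡ R
        fixes []      _   _   = refl
        fixes (x ∷ R) e∉R c∉R with x ≟ e | x ≟ c
        ... | yes refl | _        = ⊥-elim (e∉R (here refl))
        ... | no _     | yes refl = ⊥-elim (c∉R (here refl))
        ... | no _     | no _     = cong (x ∷_) (fixes R (λ p → e∉R (there p)) (λ p → c∉R (there p)))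

    -- Transposing e and c permutes the orderings of L and moves "e first" to "c first".
    #firstAmong-exchange : (L C : List A) → Unique L → (e c : A) → e ∈ L → c ∈ L → e ∈ C → c ∈ C →
                           #firstAmong c C L ≡ #firstAmong e C L
    #firstAmong-exchange L C uL e c e∈L c∈L e∈C c∈C with c ≟ e
    ... | yes refl = refl
    ... | no c≢e with ∈-∃++ e∈L
    ... | as , bs , refl with Perm.∈-resp-↭ (Perm.shift e as bs) c∈L
    ... | here c≡e = ⊥-elim (c≢e c≡e)
    ... | there c∈L₁ with ∈-∃++ c∈L₁
    ... | cs , ds , L₁≡ = begin
      ∑ (first c) (orderings L)                            ≡⟨ ∑-orderings-↭ L↭ (first c) ⟩
      ∑ (first c) (orderings (e ∷ c ∷ R))                  ≡⟨ ∑-orderings-↭ (Perm.swap {xs = R} e c Perm.refl) (first c) ⟩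
      ∑ (first c) (orderings (c ∷ e ∷ R))                  ≡⟨ cong (λ σ → ∑ (first c) (orderings σ)) swapped ⟨
      ∑ (first c) (orderings (map τ (e ∷ c ∷ R)))          ≡⟨ ∑-orderings-map τ (first c) (e ∷ c ∷ R) ⟩
      ∑ (λ σ → first c (map τ σ)) (orderings (e ∷ c ∷ R))
        ≡⟨ ∑-cong (orderings (e ∷ c ∷ R)) (λ {σ} _ → cong 𝟙 (isFirstAmong-transpose e c C e∈C c∈C σ)) ⟩
      ∑ (first e) (orderings (e ∷ c ∷ R))                  ≡⟨ ∑-orderings-↭ L↭ (first e) ⟨
      ∑ (first e) (orderings L)                            ∎
      where
      open ≡-Reasoning
      R : List A
      R = cs ++ ds
      first : A → List A → ℕ
      first x σ = 𝟙 (isFirstAmong x C σ)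
      τ : A → A
      τ = transpose e c
      L↭ : as ++ e ∷ bs ↭ e ∷ c ∷ R
      L↭ = Perm.trans (Perm.shift e as bs) (Perm.prep e (subst (_↭ c ∷ R) (sym L₁≡) (Perm.shift c cs ds)))
      uR : Unique (e ∷ c ∷ R)
      uR = Unique-resp-↭ L↭ uL
      swapped : map τ (e ∷ c ∷ R) ≡ c ∷ e ∷ R
      swapped with uR
      ... | (_ ∷ e∉R) ∷ c∉R ∷ _ =
        transpose-swaps e c c≢e R (λ p → All.lookup e∉R p refl) (λ p → All.lookup c∉R p refl)

    #firstAmong-bound : (L C : List A) → Unique L → Unique C → (∀ {c} → c ∈ C → c ∈ L) → (e : A) → e ∈ C →
                        length C * #firstAmong e C L ≤ length (orderings L)
    #firstAmong-bound L C uL uC C⊆L e e∈C = begin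
      length C * #firstAmong e C L                         ≡⟨ ∑-const _ C ⟨
      ∑ (λ _ → #firstAmong e C L) C
        ≡⟨ ∑-cong C (λ c∈C → sym (#firstAmong-exchange L C uL e _ (C⊆L e∈C) (C⊆L c∈C) e∈C c∈C)) ⟩
      ∑ (λ c → #firstAmong c C L) C                         ≡⟨ ∑-swap (λ c σ → 𝟙 (isFirstAmong c C σ)) C (orderings L) ⟩
      ∑ (λ σ → ∑ (λ c → 𝟙 (isFirstAmong c C σ)) C) (orderings L) ≤⟨ ∑-mono (orderings L) (λ {σ} _ → ∑-isFirstAmong≤1 C uC σ) ⟩
      ∑ (λ _ → 1) (orderings L)                              ≡⟨ trans (∑-const 1 (orderings L)) (*-identityʳ _) ⟩
      length (orderings L)                                   ∎
      where open ≤-Reasoning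

  Unique-⊆⇒length≤ : {xs ys : List A} → Unique xs → (∀ {x} → x ∈ xs → x ∈ ys) → length xs ≤ length ys
  Unique-⊆⇒length≤ {xs = []}     _            _  = z≤n
  Unique-⊆⇒length≤ {xs = x ∷ xs} (x∉xs ∷ uxs) xs⊆ys with ∈-∃++ (xs⊆ys (here refl))
  ... | as , bs , refl = begin
    suc (length xs)          ≤⟨ s≤s (Unique-⊆⇒length≤ uxs xs⊆as++bs) ⟩
    suc (length (as ++ bs))  ≡⟨ Perm.↭-length (Perm.shift x as bs) ⟨
    length (as ++ x ∷ bs)    ∎
    where
    open ≤-Reasoning
    xs⊆as++bs : ∀ {y} → y ∈ xs → y ∈ as ++ bs
    xs⊆as++bs {y} y∈xs with Perm.∈-resp-↭ (Perm.shift x as bs) (xs⊆ys (there y∈xs))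
    ... | here y≡x = ⊥-elim (All.lookup x∉xs y∈xs (sym y≡x))
    ... | there p  = p

  Unique-map-injectiveOn : (f : A → B) {xs : List A} → (∀ {x y} → x ∈ xs → y ∈ xs → f x ≡ f y → x ≡ y) →
                           Unique xs → Unique (map f xs)
  Unique-map-injectiveOn f {[]}     _   _            = []
  Unique-map-injectiveOn f {x ∷ xs} inj (x∉xs ∷ uxs) =
    All.tabulate fx∉ ∷ Unique-map-injectiveOn f (λ p q → inj (there p) (there q)) uxs
    where
    fx∉ : ∀ {z} → z ∈ map f xs → f x ≢ z
    fx∉ z∈ fx≡z with ∈-map⁻ f z∈
    ... | y , y∈xs , refl = All.lookup x∉xs y∈xs (inj (here refl) (there y∈xs) fx≡z)

  Unique-concatMap : (f : A → List B) (key : B → A) {xs : List A} → Unique xs →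
                     (∀ x → Unique (f x)) → (∀ {x y} → y ∈ f x → key y ≡ x) → Unique (concatMap f xs)
  Unique-concatMap f key {[]}     _            _   _   = []
  Unique-concatMap f key {x ∷ xs} (x∉xs ∷ uxs) ufx key-f =
    Unique.++⁺ (ufx x) (Unique-concatMap f key uxs ufx key-f) disjoint
    where
    disjoint : ∀ {y} → ¬ (y ∈ f x × y ∈ concatMap f xs)
    disjoint (y∈fx , y∈rest) with find (∈-concatMap⁻ f {xs = xs} y∈rest)
    ... | x′ , x′∈xs , y∈fx′ = All.lookup x∉xs x′∈xs (trans (sym (key-f y∈fx)) (key-f y∈fx′))

  Unique-++-separated : (f : A → ℕ) (k : ℕ) {xs ys : List A} → Unique xs → Unique ys →
                        (∀ {x} → x ∈ xs → f x ≡ k) → (∀ {y} → y ∈ ys → k < f y) → Unique (xs ++ ys)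
  Unique-++-separated f k uxs uys fxs fys =
    Unique.++⁺ uxs uys (λ { (y∈xs , y∈ys) → <-irrefl (sym (fxs y∈xs)) (fys y∈ys) })

  length-allFin : ∀ n → length (allFin n) ≡ n
  length-allFin n = List.length-tabulate {n = n} (λ i → i)

  elements : {n : ℕ} → Subset n → List (Fin n)
  elements []            = []
  elements (true ∷ C)  = Fin.zero ∷ map Fin.suc (elements C)
  elements (false ∷ C) = map Fin.suc (elements C)

  length-elements : {n : ℕ} (C : Subset n) → length (elements C) ≡ ∣ C ∣
  length-elements []          = refl
  length-elements (true ∷ C)  = cong suc (trans (List.length-map Fin.suc (elements C)) (length-elements C))
  length-elements (false ∷ C) = trans (List.length-map Fin.suc (elements C)) (length-elements C)

  Unique-elements : {n : ℕ} (C : Subset n) → Unique (elements C)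
  Unique-elements []          = []
  Unique-elements (true ∷ C)  = All.tabulate zero∉ ∷ Unique.map⁺ Fin.suc-injective (Unique-elements C)
    where
    zero∉ : ∀ {i} → i ∈ map Fin.suc (elements C) → Fin.zero ≢ i
    zero∉ i∈ with ∈-map⁻ Fin.suc i∈
    ... | _ , _ , refl = λ ()
  Unique-elements (false ∷ C) = Unique.map⁺ Fin.suc-injective (Unique-elements C)

  ∈-elements⁺ : {n : ℕ} (C : Subset n) {i : Fin n} → i Subset.∈ C → i ∈ elements C
  ∈-elements⁺ (true ∷ C)  Vec.here      = here refl
  ∈-elements⁺ (true ∷ C)  (Vec.there p) = there (∈-map⁺ Fin.suc (∈-elements⁺ C p))
  ∈-elements⁺ (false ∷ C) (Vec.there p) = ∈-map⁺ Fin.suc (∈-elements⁺ C p)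

  ∈-elements⁻ : {n : ℕ} (C : Subset n) {i : Fin n} → i ∈ elements C → i Subset.∈ C
  ∈-elements⁻ (true ∷ C)  (here refl) = Vec.here
  ∈-elements⁻ (true ∷ C)  (there p) with ∈-map⁻ Fin.suc p
  ... | _ , j∈ , refl = Vec.there (∈-elements⁻ C j∈)
  ∈-elements⁻ (false ∷ C) p with ∈-map⁻ Fin.suc p
  ... | _ , j∈ , refl = Vec.there (∈-elements⁻ C j∈)

  Unique-⊆⇒length≤∣∣ : {n : ℕ} (C : Subset n) {W : List (Fin n)} → Unique W →
                       (∀ {i} → i ∈ W → i Subset.∈ C) → length W ≤ ∣ C ∣
  Unique-⊆⇒length≤∣∣ C uW W⊆C =
    subst (_ ≤_) (length-elements C) (Unique-⊆⇒length≤ uW (λ i∈W → ∈-elements⁺ C (W⊆C i∈W)))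

  ⊆⇒∣∣≤length : {n : ℕ} (C : Subset n) {W : List (Fin n)} → (∀ {i} → i Subset.∈ C → i ∈ W) → ∣ C ∣ ≤ length W
  ⊆⇒∣∣≤length C C⊆W =
    subst (_≤ _) (length-elements C) (Unique-⊆⇒length≤ (Unique-elements C) (λ i∈ → C⊆W (∈-elements⁻ C i∈)))

  -- Weak duality in G

  module _ {n : ℕ} (G : Graph n) where

    coverPicks : (M : List (Fin n × Fin n)) → IsMatching G M → (C : Subset n) → IsVertexCover G C →
      Σ (List (Fin n)) λ W → length W ≡ length M × Unique W ×
                             (∀ {i} → i ∈ W → i Subset.∈ C) × (∀ {i} → i ∈ W → i ∈ endpoints M)
    coverPicks []            _ C cover = [] , refl , [] , (λ ()) , (λ ())
    coverPicks ((i , j) ∷ M) (adjij ∷ adjM , (_ ∷ i∉) ∷ (j∉ ∷ uM)) C cover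
      with coverPicks M (adjM , uM) C cover
    ... | W , lenW , uW , W⊆C , W⊆M with cover i j adjij
    ... | inj₁ i∈C = i ∷ W , cong suc lenW
        , All.tabulate (λ k∈W i≡k → All.lookup i∉ (W⊆M k∈W) i≡k) ∷ uW
        , (λ { (here refl) → i∈C ; (there p) → W⊆C p })
        , (λ { (here refl) → here refl ; (there p) → there (there (W⊆M p)) })
    ... | inj₂ j∈C = j ∷ W , cong suc lenW
        , All.tabulate (λ k∈W j≡k → All.lookup j∉ (W⊆M k∈W) j≡k) ∷ uW
        , (λ { (here refl) → j∈C ; (there p) → W⊆C p })
        , (λ { (here refl) → there (here refl) ; (there p) → there (there (W⊆M p)) })

    matching≤cover : (M : List (Fin n × Fin n)) → IsMatching G M → (C : Subset n) → IsVertexCover G C →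
                     length M ≤ ∣ C ∣
    matching≤cover M matching C cover with coverPicks M matching C cover
    ... | W , lenW , uW , W⊆C , _ = subst (_≤ ∣ C ∣) lenW (Unique-⊆⇒length≤∣∣ C uW W⊆C)

    μ≤ν : {μ ν : ℕ} → IsMaxMatchingSize G μ → IsMinVertexCoverSize G ν → μ ≤ ν
    μ≤ν ((M , matching , refl) , _) ((C , cover , refl) , _) = matching≤cover M matching C cover

  ∈-endpoints₁ : ∀ {a b : A} M → (a , b) ∈ M → a ∈ endpoints M
  ∈-endpoints₁ (_ ∷ M) (here refl) = here refl
  ∈-endpoints₁ (_ ∷ M) (there p)   = there (there (∈-endpoints₁ M p))

  ∈-endpoints₂ : ∀ {a b : A} M → (a , b) ∈ M → b ∈ endpoints M
  ∈-endpoints₂ (_ ∷ M) (here refl) = there (here refl)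
  ∈-endpoints₂ (_ ∷ M) (there p)   = there (there (∈-endpoints₂ M p))

  endpoints-map : (f : A → B) (M : List (A × A)) →
                  endpoints (map (λ e → f (proj₁ e) , f (proj₂ e)) M) ≡ map f (endpoints M)
  endpoints-map f []            = refl
  endpoints-map f ((a , b) ∷ M) = cong (λ rest → f a ∷ f b ∷ rest) (endpoints-map f M)

  ∈-endpoints-filterᵇ : (p : A × A → Bool) (M : List (A × A)) {z : A} →
                        z ∈ endpoints (filterᵇ p M) → z ∈ endpoints M
  ∈-endpoints-filterᵇ p ((a , b) ∷ M) z∈ with p (a , b)
  ∈-endpoints-filterᵇ p ((a , b) ∷ M) (here refl)         | true = here refl
  ∈-endpoints-filterᵇ p ((a , b) ∷ M) (there (here refl)) | true = there (here refl)
  ∈-endpoints-filterᵇ p ((a , b) ∷ M) (there (there q))   | true = there (there (∈-endpoints-filterᵇ p M q))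
  ... | false = there (there (∈-endpoints-filterᵇ p M z∈))

  Unique-endpoints-filterᵇ : (p : A × A → Bool) (M : List (A × A)) →
                             Unique (endpoints M) → Unique (endpoints (filterᵇ p M))
  Unique-endpoints-filterᵇ p []            _ = []
  Unique-endpoints-filterᵇ p ((a , b) ∷ M) ((a≢b ∷ a∉) ∷ (b∉ ∷ unique)) with p (a , b)
  ... | true  = (a≢b ∷ All.tabulate (All.lookup a∉ ∘ ∈-endpoints-filterᵇ p M))
              ∷ (All.tabulate (All.lookup b∉ ∘ ∈-endpoints-filterᵇ p M) ∷ Unique-endpoints-filterᵇ p M unique)
  ... | false = Unique-endpoints-filterᵇ p M unique

  Unique-endpoints⇒Unique : (M : List (A × A)) → Unique (endpoints M) → Unique M
  Unique-endpoints⇒Unique []            _ = []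
  Unique-endpoints⇒Unique ((a , b) ∷ M) ((_ ∷ a∉) ∷ (_ ∷ unique)) =
    All.tabulate (λ e∈M ab≡e → All.lookup a∉ (∈-endpoints₁ M (subst (_∈ M) (sym ab≡e) e∈M)) refl)
    ∷ Unique-endpoints⇒Unique M unique

  -- The greedy matching

  module Greedy {n s : ℕ} where

    ∈V?⇒∈ : ∀ (a : VH n s) xs → (a ∈V? xs) ≡ true → a ∈ xs
    ∈V?⇒∈ a (b ∷ xs) eq with a ≟V b
    ... | yes refl = here refl
    ... | no _     = there (∈V?⇒∈ a xs eq)

    ∈V?≡false⇒∉ : ∀ (a : VH n s) xs → (a ∈V? xs) ≡ false → a ∉ xs
    ∈V?≡false⇒∉ a (b ∷ xs) eq a∈ with a ≟V b | a∈
    ∈V?≡false⇒∉ a (b ∷ xs) () a∈ | yes _ | _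
    ... | no a≢b | here a≡b = a≢b a≡b
    ... | no _   | there p  = ∈V?≡false⇒∉ a xs eq p

    ∈⇒∈V? : ∀ (a : VH n s) xs → a ∈ xs → (a ∈V? xs) ≡ true
    ∈⇒∈V? a xs a∈ with a ∈V? xs in eq
    ... | true  = refl
    ... | false = ⊥-elim (∈V?≡false⇒∉ a xs eq a∈)

    gmm-⊆ : ∀ es (used : List (VH n s)) {x} → x ∈ gmmAux es used → x ∈ es
    gmm-⊆ ((a , b) ∷ es) used x∈ with (a ∈V? used) ∨ (b ∈V? used)
    ... | true = there (gmm-⊆ es used x∈)
    gmm-⊆ ((a , b) ∷ es) used (here refl) | false = here refl
    gmm-⊆ ((a , b) ∷ es) used (there x∈)  | false = there (gmm-⊆ es (a ∷ b ∷ used) x∈)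

    Unique-endpoints-gmm : ∀ es (used : List (VH n s)) → All (λ e → proj₁ e ≢ proj₂ e) es →
      Unique (endpoints (gmmAux es used)) × (∀ {y} → y ∈ endpoints (gmmAux es used) → y ∉ used)
    Unique-endpoints-gmm []             used _ = [] , λ ()
    Unique-endpoints-gmm ((a , b) ∷ es) used (a≢b ∷ loopless) with (a ∈V? used) ∨ (b ∈V? used) in eq
    ... | true  = Unique-endpoints-gmm es used loopless
    ... | false with Unique-endpoints-gmm es (a ∷ b ∷ used) loopless
    ... | unique , fresh = (a≢b ∷ All.tabulate (λ y∈ a≡y → fresh y∈ (here (sym a≡y))))
                         ∷ (All.tabulate (λ y∈ b≡y → fresh y∈ (there (here (sym b≡y)))) ∷ unique)
                         , fresh′
      where
      fresh′ : ∀ {y} → y ∈ a ∷ b ∷ endpoints (gmmAux es (a ∷ b ∷ used)) → y ∉ used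
      fresh′ (here refl)         = ∈V?≡false⇒∉ a used (∨-conicalˡ _ _ eq)
      fresh′ (there (here refl)) = ∈V?≡false⇒∉ b used (∨-conicalʳ _ _ eq)
      fresh′ (there (there p)) q = fresh p (there (there q))

    Covered : List (VH n s) → List (VH n s × VH n s) → VH n s → Set
    Covered used M a = a ∈ used ⊎ a ∈ endpoints M

    gmm-maximal : ∀ es (used : List (VH n s)) {a b} → (a , b) ∈ es →
                  Covered used (gmmAux es used) a ⊎ Covered used (gmmAux es used) b
    gmm-maximal ((a , b) ∷ es) used (here refl) with (a ∈V? used) in ea | (b ∈V? used) in eb
    ... | true  | _     = inj₁ (inj₁ (∈V?⇒∈ a used ea))
    ... | false | true  = inj₂ (inj₁ (∈V?⇒∈ b used eb))
    ... | false | false = inj₁ (inj₂ (here refl))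
    gmm-maximal ((a , b) ∷ es) used (there p) with (a ∈V? used) ∨ (b ∈V? used)
    ... | true  = gmm-maximal es used p
    ... | false = Data.Sum.map lift lift (gmm-maximal es (a ∷ b ∷ used) p)
      where
      lift : ∀ {c} → Covered (a ∷ b ∷ used) (gmmAux es (a ∷ b ∷ used)) c →
                     Covered used ((a , b) ∷ gmmAux es (a ∷ b ∷ used)) c
      lift (inj₁ (here refl))         = inj₂ (here refl)
      lift (inj₁ (there (here refl))) = inj₂ (there (here refl))
      lift (inj₁ (there (there q)))   = inj₁ q
      lift (inj₂ q)                   = inj₂ (there (there q))

  -- The graph H

  module H {n : ℕ} (G : Graph n) (s : ℕ) where

    V : Set
    V = VH n s

    Edge : Set
    Edge = V × V

    _≟E_ : DecidableEquality Edge
    _≟E_ = ≡-dec _≟V_ _≟V_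

    index : V → Fin n
    index (v1 i)  = i
    index (v2 i)  = i
    index (u i k) = i

    -- A verbatim copy of the local definitions of edgesH, so that edges is definitionally edgesH G s.
    pairsWhere : (Fin n → Fin n → Bool) → (Fin n → Fin n → Edge) → List Edge
    pairsWhere P f = concatMap (λ i → concatMap (λ j → if P i j then f i j ∷ [] else []) (allFin n)) (allFin n)

    lt-adj : Fin n → Fin n → Bool
    lt-adj i j = adj G i j ∧ (toℕ i <ᵇ toℕ j)

    pendants : Fin n → List Edge
    pendants j = map (λ k → v2 j , u j k) (allFin s)

    E₁₁ E₂₂ E₁₂ Eᵤ edges : List Edge
    E₁₁   = pairsWhere lt-adj (λ i j → v1 i , v1 j)
    E₂₂   = pairsWhere lt-adj (λ i j → v2 i , v2 j)
    E₁₂   = pairsWhere (λ i j → not (adj G i j)) (λ i j → v1 i , v2 j)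
    Eᵤ    = concatMap pendants (allFin n)
    edges = E₁₁ ++ E₂₂ ++ E₁₂ ++ Eᵤ

    module _ (P : Fin n → Fin n → Bool) (f : Fin n → Fin n → Edge) where

      private
        cell : Fin n → Fin n → List Edge
        cell i j = if P i j then f i j ∷ [] else []

        ∈-cell⁻ : ∀ i j {x} → x ∈ cell i j → P i j ≡ true × x ≡ f i j
        ∈-cell⁻ i j x∈ with P i j
        ∈-cell⁻ i j (here refl) | true = refl , refl

      ∈-pairsWhere⁻ : ∀ {x} → x ∈ pairsWhere P f → ∃₂ λ i j → P i j ≡ true × x ≡ f i j
      ∈-pairsWhere⁻ x∈ with find (∈-concatMap⁻ _ {xs = allFin n} x∈)
      ... | i , _ , x∈row with find (∈-concatMap⁻ _ {xs = allFin n} x∈row)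
      ... | j , _ , x∈cell = i , j , ∈-cell⁻ i j x∈cell

      ∈-pairsWhere⁺ : ∀ {i j} → P i j ≡ true → f i j ∈ pairsWhere P f
      ∈-pairsWhere⁺ {i} {j} Pij =
        ∈-concatMap⁺ _ (lose (∈-allFin i) (∈-concatMap⁺ (cell i) (lose (∈-allFin j) fij∈cell)))
        where
        fij∈cell : f i j ∈ cell i j
        fij∈cell rewrite Pij = here refl

      Unique-pairsWhere : (∀ i j → index (proj₁ (f i j)) ≡ i) → (∀ i j → index (proj₂ (f i j)) ≡ j) →
                          Unique (pairsWhere P f)
      Unique-pairsWhere key₁-f key₂-f =
        Unique-concatMap _ key₁ (Unique.allFin⁺ n) Unique-row key₁-row
        where
        key₁ key₂ : Edge → Fin n
        key₁ = index ∘ proj₁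
        key₂ = index ∘ proj₂
        key-cell : ∀ (key : Edge → Fin n) {g : Fin n → Fin n → Fin n} → (∀ i j → key (f i j) ≡ g i j) →
                   ∀ {i j x} → x ∈ cell i j → key x ≡ g i j
        key-cell key key-f {i} {j} x∈ with ∈-cell⁻ i j x∈
        ... | _ , refl = key-f i j
        Unique-cell : ∀ i j → Unique (cell i j)
        Unique-cell i j with P i j
        ... | true  = [] ∷ []
        ... | false = []
        Unique-row : ∀ i → Unique (concatMap (cell i) (allFin n))
        Unique-row i = Unique-concatMap (cell i) key₂ (Unique.allFin⁺ n) (Unique-cell i) (key-cell key₂ key₂-f)
        key₁-row : ∀ {i x} → x ∈ concatMap (cell i) (allFin n) → key₁ x ≡ i
        key₁-row {i} x∈ with find (∈-concatMap⁻ (cell i) {xs = allFin n} x∈)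
        ... | j , _ , x∈cell = key-cell key₁ key₁-f x∈cell

    Shaped : Edge → Set
    Shaped (v1 i , v1 j)  = adj G i j ≡ true
    Shaped (v2 i , v2 j)  = adj G i j ≡ true
    Shaped (v1 i , v2 j)  = ⊤
    Shaped (v2 j , u i k) = j ≡ i
    Shaped _              = ⊥

    false≢true : false ≢ true
    false≢true ()

    Shaped⇒≢ : ∀ {a b} → Shaped (a , b) → a ≢ b
    Shaped⇒≢ {v1 i} {v1 .i} adjii refl = false≢true (trans (sym (irrefl G i)) adjii)
    Shaped⇒≢ {v2 i} {v2 .i} adjii refl = false≢true (trans (sym (irrefl G i)) adjii)

    ∈-pendants⁻ : ∀ {j x} → x ∈ pendants j → ∃ λ k → x ≡ (v2 j , u j k)
    ∈-pendants⁻ x∈ with ∈-map⁻ _ x∈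
    ... | k , _ , x≡ = k , x≡

    ∈-Eᵤ⁻ : ∀ {x} → x ∈ Eᵤ → ∃₂ λ j k → x ≡ (v2 j , u j k)
    ∈-Eᵤ⁻ x∈ with find (∈-concatMap⁻ pendants {xs = allFin n} x∈)
    ... | j , _ , x∈pj = j , ∈-pendants⁻ x∈pj

    edges-Shaped : ∀ {x} → x ∈ edges → Shaped x
    edges-Shaped x∈ with ∈-++⁻ E₁₁ x∈
    ... | inj₁ p with ∈-pairsWhere⁻ lt-adj _ p
    ... | i , j , eq , refl = ∧-conicalˡ _ _ eq
    edges-Shaped x∈ | inj₂ q with ∈-++⁻ E₂₂ q
    ... | inj₁ p with ∈-pairsWhere⁻ lt-adj _ p
    ... | i , j , eq , refl = ∧-conicalˡ _ _ eq
    edges-Shaped x∈ | inj₂ q | inj₂ r with ∈-++⁻ E₁₂ r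
    ... | inj₁ p with ∈-pairsWhere⁻ _ _ p
    ... | i , j , eq , refl = tt
    edges-Shaped x∈ | inj₂ q | inj₂ r | inj₂ t with ∈-Eᵤ⁻ t
    ... | j , k , refl = refl

    block : Edge → ℕ
    block (v1 _ , v1 _) = 0
    block (v2 _ , v2 _) = 1
    block (v1 _ , v2 _) = 2
    block _             = 3

    block-pairsWhere : ∀ {P} f t → (∀ i j → block (f i j) ≡ t) → ∀ {x} → x ∈ pairsWhere P f → block x ≡ t
    block-pairsWhere {P} f t block-f x∈ with ∈-pairsWhere⁻ P f x∈
    ... | i , j , _ , refl = block-f i j

    block-Eᵤ : ∀ {x} → x ∈ Eᵤ → block x ≡ 3
    block-Eᵤ x∈ with ∈-Eᵤ⁻ x∈
    ... | _ , _ , refl = refl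

    2≤block : ∀ {x} → x ∈ E₁₂ ++ Eᵤ → 2 ≤ block x
    2≤block x∈ with ∈-++⁻ E₁₂ x∈
    ... | inj₁ p = ≤-reflexive (sym (block-pairsWhere _ 2 (λ _ _ → refl) p))
    ... | inj₂ p = subst (2 ≤_) (sym (block-Eᵤ p)) (n≤1+n 2)

    1≤block : ∀ {x} → x ∈ E₂₂ ++ E₁₂ ++ Eᵤ → 1 ≤ block x
    1≤block x∈ with ∈-++⁻ E₂₂ x∈
    ... | inj₁ p = ≤-reflexive (sym (block-pairsWhere _ 1 (λ _ _ → refl) p))
    ... | inj₂ p = ≤-trans (n≤1+n 1) (2≤block p)

    Unique-edges : Unique edges
    Unique-edges =
      Unique-++-separated block 0 (Unique-pairsWhere lt-adj _ (λ _ _ → refl) (λ _ _ → refl))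
        (Unique-++-separated block 1 (Unique-pairsWhere lt-adj _ (λ _ _ → refl) (λ _ _ → refl))
          (Unique-++-separated block 2 (Unique-pairsWhere _ _ (λ _ _ → refl) (λ _ _ → refl)) Unique-Eᵤ
            (block-pairsWhere _ 2 (λ _ _ → refl)) (λ x∈ → ≤-reflexive (sym (block-Eᵤ x∈))))
          (block-pairsWhere _ 1 (λ _ _ → refl)) 2≤block)
        (block-pairsWhere _ 0 (λ _ _ → refl)) 1≤block
      where
      Unique-Eᵤ : Unique Eᵤ
      Unique-Eᵤ = Unique-concatMap pendants (index ∘ proj₁) (Unique.allFin⁺ n)
        (λ j → Unique.map⁺ (λ { refl → refl }) (Unique.allFin⁺ s))
        (λ x∈ → cong (index ∘ proj₁) (proj₂ (∈-pendants⁻ x∈)))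

    pendant∈edges : ∀ j k → (v2 j , u j k) ∈ edges
    pendant∈edges j k = ∈-++⁺ʳ E₁₁ (∈-++⁺ʳ E₂₂ (∈-++⁺ʳ E₁₂
      (∈-concatMap⁺ pendants (lose (∈-allFin j) (∈-map⁺ (λ k → v2 j , u j k) (∈-allFin k))))))

    lt-adj-true : ∀ {i j} → adj G i j ≡ true → toℕ i < toℕ j → lt-adj i j ≡ true
    lt-adj-true {i} {j} adjij i<j rewrite adjij = Equivalence.to T-≡ (<⇒<ᵇ i<j)

    adj⇒V₁-edge : ∀ i j → adj G i j ≡ true → (v1 i , v1 j) ∈ edges ⊎ (v1 j , v1 i) ∈ edges
    adj⇒V₁-edge i j adjij with <-cmp (toℕ i) (toℕ j)
    ... | tri< i<j _ _ = inj₁ (∈-++⁺ˡ (∈-pairsWhere⁺ lt-adj _ (lt-adj-true adjij i<j)))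
    ... | tri> _ _ j<i = inj₂ (∈-++⁺ˡ (∈-pairsWhere⁺ lt-adj _ (lt-adj-true (trans (Graph.sym G j i) adjij) j<i)))
    ... | tri≈ _ i≡j _ with Fin.toℕ-injective i≡j
    ... | refl = ⊥-elim (false≢true (trans (sym (irrefl G i)) adjij))

    open Greedy
    open FirstAmong _≟E_
    open import Data.List.Membership.DecPropositional _≟E_ using (_∈?_)

    rivals : Edge → List Edge
    rivals e = e ∷ pendants (index (proj₂ e))

    All-Shaped⇒loopless : ∀ {es} → All Shaped es → All (λ e → proj₁ e ≢ proj₂ e) es
    All-Shaped⇒loopless = All.map Shaped⇒≢

    PendantsGuarded : Fin n → List V → Set
    PendantsGuarded j used = ∀ {k} → u j k ∈ used → v2 j ∈ used

    PendantsGuarded-step : ∀ {j a b used} → Shaped (a , b) → PendantsGuarded j used → PendantsGuarded j (a ∷ b ∷ used)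
    PendantsGuarded-step {a = v2 _} {b = u _ _} refl guard (there (here refl)) = here refl
    PendantsGuarded-step {a = v1 _} {b = v1 _} _ guard (there (there p)) = there (there (guard p))
    PendantsGuarded-step {a = v1 _} {b = v2 _} _ guard (there (there p)) = there (there (guard p))
    PendantsGuarded-step {a = v2 _} {b = v2 _} _ guard (there (there p)) = there (there (guard p))
    PendantsGuarded-step {a = v2 _} {b = u _ _} _ guard (there (there p)) = there (there (guard p))

    -- A pendant vertex u j k is only ever matched to v2 j, so once a pendant edge at v2 j is scanned,
    -- v2 j is matched and (v1 i , v2 j) can no longer be chosen.
    gmm-cross⇒first : ∀ i j es used → All Shaped es → PendantsGuarded j used →
                      (v1 i , v2 j) ∈ gmmAux es used → isFirstAmong (v1 i , v2 j) (rivals (v1 i , v2 j)) es ≡ true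
    gmm-cross⇒first i j ((a , b) ∷ es) used (shaped ∷ shapedEs) guard e∈ with (a , b) ∈? rivals (v1 i , v2 j)
    ... | yes (here refl) =
      trans (isFirstAmong-∈ (rivals (v1 i , v2 j)) es (here refl)) (dec-true ((v1 i , v2 j) ≟E (v1 i , v2 j)) refl)
    ... | yes (there p) with ∈-pendants⁻ p
    ... | k , refl = ⊥-elim (not-chosen e∈)
      where
      not-chosen : (v1 i , v2 j) ∉ gmmAux ((v2 j , u j k) ∷ es) used
      not-chosen e∈′ with v2 j ∈V? used in v2∈? | u j k ∈V? used in u∈?
      ... | true  | _     = proj₂ (Unique-endpoints-gmm es used (All-Shaped⇒loopless shapedEs)) (∈-endpoints₂ _ e∈′) (∈V?⇒∈ _ used v2∈?)
      ... | false | true  = ∈V?≡false⇒∉ _ used v2∈? (guard (∈V?⇒∈ _ used u∈?))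
      ... | false | false with e∈′
      ... | there e∈rest = proj₂ (Unique-endpoints-gmm es _ (All-Shaped⇒loopless shapedEs)) (∈-endpoints₂ _ e∈rest) (here refl)
    gmm-cross⇒first i j ((a , b) ∷ es) used (shaped ∷ shapedEs) guard e∈ | no ab∉ with (a ∈V? used) ∨ (b ∈V? used)
    ... | true = trans (isFirstAmong-∉ (rivals (v1 i , v2 j)) es ab∉) (gmm-cross⇒first i j es used shapedEs guard e∈)
    ... | false with e∈
    ... | here e≡ab = ⊥-elim (ab∉ (here (sym e≡ab)))
    ... | there e∈rest = trans (isFirstAmong-∉ (rivals (v1 i , v2 j)) es ab∉)
            (gmm-cross⇒first i j es (a ∷ b ∷ used) shapedEs (PendantsGuarded-step shaped guard) e∈rest)

    bothV₁ : Edge → Bool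
    bothV₁ e = isV1 (proj₁ e) ∧ isV1 (proj₂ e)

    isCross : Edge → Bool
    isCross (v1 _ , v2 _) = true
    isCross _             = false

    crossEdges : List Edge
    crossEdges = filterᵇ isCross edges

    leadsRivals : List Edge → Edge → Bool
    leadsRivals σ e = isFirstAmong e (rivals e) σ

    v1Indices : V → List (Fin n)
    v1Indices (v1 i) = i ∷ []
    v1Indices _      = []

    module OnOrdering (σ : List Edge) (σ↭ : σ ↭ edges) where

      σ-Shaped : All Shaped σ
      σ-Shaped = All.tabulate (λ x∈ → edges-Shaped (Perm.∈-resp-↭ σ↭ x∈))

      M : List Edge
      M = GMM σ

      M-Shaped : All Shaped M
      M-Shaped = All.tabulate (λ x∈ → All.lookup σ-Shaped (gmm-⊆ σ [] x∈))

      Unique-endpoints-M : Unique (endpoints M)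
      Unique-endpoints-M = proj₁ (Unique-endpoints-gmm σ [] (All-Shaped⇒loopless σ-Shaped))

      M₁ : List Edge
      M₁ = filterᵇ bothV₁ M

      project : Edge → Fin n × Fin n
      project e = index (proj₁ e) , index (proj₂ e)

      endpoints-bothV₁-isV1 : ∀ (X : List Edge) {z} → z ∈ endpoints (filterᵇ bothV₁ X) → isV1 z ≡ true
      endpoints-bothV₁-isV1 ((a , b) ∷ X) z∈ with isV1 a in a∈V₁ | isV1 b in b∈V₁
      endpoints-bothV₁-isV1 ((a , b) ∷ X) (here refl)         | true | true = a∈V₁
      endpoints-bothV₁-isV1 ((a , b) ∷ X) (there (here refl)) | true | true = b∈V₁
      endpoints-bothV₁-isV1 ((a , b) ∷ X) (there (there q))   | true | true = endpoints-bothV₁-isV1 X q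
      ... | true  | false = endpoints-bothV₁-isV1 X z∈
      ... | false | _     = endpoints-bothV₁-isV1 X z∈

      index-injective-V₁ : ∀ {a b : V} → isV1 a ≡ true → isV1 b ≡ true → index a ≡ index b → a ≡ b
      index-injective-V₁ {v1 _} {v1 _} _ _ refl = refl

      adj-M₁ : ∀ {e} → e ∈ M₁ → adj G (index (proj₁ e)) (index (proj₂ e)) ≡ true
      adj-M₁ {e} e∈ with ∈-filter⁻ (T? ∘ bothV₁) {xs = M} e∈
      ... | e∈M , both = shaped-V₁V₁ e (All.lookup M-Shaped e∈M) (Equivalence.to T-≡ both)
        where
        shaped-V₁V₁ : ∀ e → Shaped e → bothV₁ e ≡ true → adj G (index (proj₁ e)) (index (proj₂ e)) ≡ true
        shaped-V₁V₁ (v1 _ , v1 _) adj≡ _ = adj≡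
        shaped-V₁V₁ (v1 _ , v2 _) _    ()

      M₁-matching : IsMatching G (map project M₁)
      M₁-matching =
        All.tabulate (λ x∈ → let e , e∈ , x≡ = ∈-map⁻ project x∈ in subst (λ x → adj G (proj₁ x) (proj₂ x) ≡ true) (sym x≡) (adj-M₁ e∈)) ,
        subst Unique (sym (endpoints-map index M₁))
          (Unique-map-injectiveOn index
            (λ p q → index-injective-V₁ (endpoints-bothV₁-isV1 M p) (endpoints-bothV₁-isV1 M q))
            (Unique-endpoints-filterᵇ bothV₁ M Unique-endpoints-M))

      ∈σ : ∀ {e} → e ∈ edges → e ∈ σ
      ∈σ = Perm.∈-resp-↭ (Perm.↭-sym σ↭)

      matched : ∀ {a} → Covered [] M a → a ∈ endpoints M
      matched (inj₂ p) = p

      cover : Subset n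
      cover = Vec.tabulate (λ i → v1 i ∈V? endpoints M)

      ∈-cover⁺ : ∀ {i} → v1 i ∈ endpoints M → i Subset.∈ cover
      ∈-cover⁺ {i} p = Vecₚ.lookup⇒[]= i cover (trans (Vecₚ.lookup∘tabulate _ i) (∈⇒∈V? (v1 i) (endpoints M) p))

      ∈-cover⁻ : ∀ {i} → i Subset.∈ cover → v1 i ∈ endpoints M
      ∈-cover⁻ {i} p = ∈V?⇒∈ (v1 i) (endpoints M) (trans (sym (Vecₚ.lookup∘tabulate _ i)) (Vecₚ.[]=⇒lookup p))

      -- Maximality of the greedy matching, applied to the copy of G on V₁.
      cover-isVertexCover : IsVertexCover G cover
      cover-isVertexCover i j adjij with adj⇒V₁-edge i j adjij
      ... | inj₁ e∈ = Data.Sum.map ∈-cover⁺ ∈-cover⁺ (Data.Sum.map matched matched (gmm-maximal σ [] (∈σ e∈)))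
      ... | inj₂ e∈ = Data.Sum.swap (Data.Sum.map ∈-cover⁺ ∈-cover⁺ (Data.Sum.map matched matched (gmm-maximal σ [] (∈σ e∈))))

      V₁-matched : List (Fin n)
      V₁-matched = concatMap v1Indices (endpoints M)

      ∣cover∣≤V₁-matched : ∣ cover ∣ ≤ length V₁-matched
      ∣cover∣≤V₁-matched = ⊆⇒∣∣≤length cover (λ i∈ → ∈-concatMap⁺ v1Indices (lose (∈-cover⁻ i∈) (here refl)))

      V₁-matched-bound : length V₁-matched ≤ 2 * M1size σ + length (filterᵇ isCross M)
      V₁-matched-bound = begin
        length V₁-matched
          ≡⟨ length-concatMap v1Indices (endpoints M) ⟩
        ∑ (length ∘ v1Indices) (endpoints M)
          ≡⟨ ∑-concatMap (length ∘ v1Indices) (λ e → proj₁ e ∷ proj₂ e ∷ []) M ⟩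
        ∑ (λ e → ∑ (length ∘ v1Indices) (proj₁ e ∷ proj₂ e ∷ [])) M
          ≤⟨ ∑-mono M (λ e∈ → per-edge _ (All.lookup M-Shaped e∈)) ⟩
        ∑ (λ e → 2 * 𝟙 (bothV₁ e) + 𝟙 (isCross e)) M
          ≡⟨ ∑-+ (λ e → 2 * 𝟙 (bothV₁ e)) (λ e → 𝟙 (isCross e)) M ⟩
        ∑ (λ e → 2 * 𝟙 (bothV₁ e)) M + ∑ (λ e → 𝟙 (isCross e)) M
          ≡⟨ cong₂ _+_ (trans (∑-*ˡ 2 (λ e → 𝟙 (bothV₁ e)) M) (cong (2 *_) (sym (length-filterᵇ bothV₁ M))))
                       (sym (length-filterᵇ isCross M)) ⟩
        2 * M1size σ + length (filterᵇ isCross M) ∎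
        where
        open ≤-Reasoning
        per-edge : ∀ e → Shaped e → ∑ (length ∘ v1Indices) (proj₁ e ∷ proj₂ e ∷ []) ≤ 2 * 𝟙 (bothV₁ e) + 𝟙 (isCross e)
        per-edge (v1 _ , v1 _)  _ = ≤-refl
        per-edge (v1 _ , v2 _)  _ = ≤-refl
        per-edge (v2 _ , v2 _)  _ = z≤n
        per-edge (v2 _ , u _ _) _ = z≤n

      cross-M≤leaders : length (filterᵇ isCross M) ≤ ∑ (λ e → 𝟙 (leadsRivals σ e)) crossEdges
      cross-M≤leaders = subst (length (filterᵇ isCross M) ≤_) (length-filterᵇ (leadsRivals σ) crossEdges)
        (Unique-⊆⇒length≤ (Unique.filter⁺ (T? ∘ isCross) (Unique-endpoints⇒Unique M Unique-endpoints-M)) leads)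
        where
        leads : ∀ {e} → e ∈ filterᵇ isCross M → e ∈ filterᵇ (leadsRivals σ) crossEdges
        leads {e} e∈ with ∈-filter⁻ (T? ∘ isCross) {xs = M} e∈
        leads {v1 i , v2 j} e∈ | e∈M , _ =
          ∈-filter⁺ (T? ∘ leadsRivals σ)
            (∈-filter⁺ (T? ∘ isCross) (Perm.∈-resp-↭ σ↭ (gmm-⊆ σ [] e∈M)) _)
            (Equivalence.from T-≡ (gmm-cross⇒first i j σ [] σ-Shaped (λ ()) e∈M))

      ν≤2*M1size+leaders : ∀ {ν} → IsMinVertexCoverSize G ν → ν ≤ 2 * M1size σ + ∑ (λ e → 𝟙 (leadsRivals σ e)) crossEdges
      ν≤2*M1size+leaders {ν} (_ , minimal) = begin
        ν                                                       ≤⟨ minimal cover cover-isVertexCover ⟩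
        ∣ cover ∣                                               ≤⟨ ∣cover∣≤V₁-matched ⟩
        length V₁-matched                                       ≤⟨ V₁-matched-bound ⟩
        2 * M1size σ + length (filterᵇ isCross M)              ≤⟨ +-monoʳ-≤ (2 * M1size σ) cross-M≤leaders ⟩
        2 * M1size σ + ∑ (λ e → 𝟙 (leadsRivals σ e)) crossEdges ∎
        where open ≤-Reasoning

      M1size≤μ : ∀ {μ} → IsMaxMatchingSize G μ → M1size σ ≤ μ
      M1size≤μ (_ , maximal) = subst (_≤ _) (List.length-map project M₁) (maximal (map project M₁) M₁-matching)

    length-crossEdges : length crossEdges ≤ n * n
    length-crossEdges = subst (length crossEdges ≤_) length-allCross
      (Unique-⊆⇒length≤ (Unique.filter⁺ (T? ∘ isCross) Unique-edges) ⊆allCross)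
      where
      allCross : List Edge
      allCross = concatMap (λ i → map (λ j → v1 i , v2 j) (allFin n)) (allFin n)
      length-allCross : length allCross ≡ n * n
      length-allCross = begin
        length allCross                                        ≡⟨ length-concatMap _ (allFin n) ⟩
        ∑ (λ i → length (map (λ j → v1 i , v2 j) (allFin n))) (allFin n)
          ≡⟨ ∑-cong (allFin n) (λ {i} _ → trans (List.length-map _ (allFin n)) (length-allFin n)) ⟩
        ∑ (λ _ → n) (allFin n)                                 ≡⟨ ∑-const n (allFin n) ⟩
        length (allFin n) * n                                  ≡⟨ cong (_* n) (length-allFin n) ⟩
        n * n                                                  ∎
        where open ≡-Reasoning
      ⊆allCross : ∀ {e} → e ∈ crossEdges → e ∈ allCross
      ⊆allCross {e} e∈ with ∈-filter⁻ (T? ∘ isCross) {xs = edges} e∈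
      ⊆allCross {v1 i , v2 j} e∈ | _ = ∈-concatMap⁺ _ (lose (∈-allFin i) (∈-map⁺ _ (∈-allFin j)))

    -- Among the s + 1 rivals of a cross edge, each is first in the same number of orderings.
    #firstAmong-rivals-bound : ∀ {e} → e ∈ crossEdges →
                               suc s * #firstAmong e (rivals e) edges ≤ length (orderings edges)
    #firstAmong-rivals-bound {e} e∈ with ∈-filter⁻ (T? ∘ isCross) {xs = edges} e∈
    #firstAmong-rivals-bound {v1 i , v2 j} e∈ | e∈edges , _ =
      subst (λ k → k * #firstAmong (v1 i , v2 j) (rivals (v1 i , v2 j)) edges ≤ length (orderings edges))
        length-rivals
        (#firstAmong-bound edges (rivals (v1 i , v2 j)) Unique-edges Unique-rivals rivals⊆edges _ (here refl))
      where
      length-rivals : length (rivals (v1 i , v2 j)) ≡ suc s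
      length-rivals = cong suc (trans (List.length-map _ (allFin s)) (length-allFin s))
      Unique-rivals : Unique (rivals (v1 i , v2 j))
      Unique-rivals = All.tabulate (λ x∈ eq → not-pendant x∈ eq) ∷ Unique.map⁺ (λ { refl → refl }) (Unique.allFin⁺ s)
        where
        not-pendant : ∀ {x} → x ∈ pendants j → (v1 i , v2 j) ≢ x
        not-pendant x∈ with ∈-pendants⁻ x∈
        ... | _ , refl = λ ()
      rivals⊆edges : ∀ {x} → x ∈ rivals (v1 i , v2 j) → x ∈ edges
      rivals⊆edges (here refl) = e∈edges
      rivals⊆edges (there x∈) with ∈-pendants⁻ x∈
      ... | k , refl = pendant∈edges j k

    orders : List (List Edge)
    orders = orderings edges

    leaders : ℕ
    leaders = ∑ (λ σ → ∑ (λ e → 𝟙 (leadsRivals σ e)) crossEdges) orders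

    ∑M1size≤ : ∀ {μ} → IsMaxMatchingSize G μ → ∑ M1size orders ≤ length orders * μ
    ∑M1size≤ {μ} maxμ = begin
      ∑ M1size orders       ≤⟨ ∑-mono orders (λ σ∈ → OnOrdering.M1size≤μ _ (∈-orderings⇒↭ edges σ∈) maxμ) ⟩
      ∑ (λ _ → μ) orders    ≡⟨ ∑-const μ orders ⟩
      length orders * μ     ∎
      where open ≤-Reasoning

    ≤∑M1size : ∀ {ν} → IsMinVertexCoverSize G ν → length orders * ν ≤ 2 * ∑ M1size orders + leaders
    ≤∑M1size {ν} minν = begin
      length orders * ν
        ≡⟨ ∑-const ν orders ⟨
      ∑ (λ _ → ν) orders
        ≤⟨ ∑-mono orders (λ σ∈ → OnOrdering.ν≤2*M1size+leaders _ (∈-orderings⇒↭ edges σ∈) minν) ⟩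
      ∑ (λ σ → 2 * M1size σ + ∑ (λ e → 𝟙 (leadsRivals σ e)) crossEdges) orders
        ≡⟨ ∑-+ (λ σ → 2 * M1size σ) _ orders ⟩
      ∑ (λ σ → 2 * M1size σ) orders + leaders
        ≡⟨ cong (_+ leaders) (∑-*ˡ 2 M1size orders) ⟩
      2 * ∑ M1size orders + leaders ∎
      where open ≤-Reasoning

    leaders-bound : suc s * leaders ≤ length orders * (n * n)
    leaders-bound = begin
      suc s * leaders
        ≡⟨ cong (suc s *_) (∑-swap (λ σ e → 𝟙 (leadsRivals σ e)) orders crossEdges) ⟩
      suc s * ∑ (λ e → #firstAmong e (rivals e) edges) crossEdges
        ≡⟨ ∑-*ˡ (suc s) _ crossEdges ⟨
      ∑ (λ e → suc s * #firstAmong e (rivals e) edges) crossEdges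
        ≤⟨ ∑-mono crossEdges #firstAmong-rivals-bound ⟩
      ∑ (λ _ → length orders) crossEdges
        ≡⟨ ∑-const _ crossEdges ⟩
      length crossEdges * length orders
        ≤⟨ *-monoˡ-≤ (length orders) length-crossEdges ⟩
      n * n * length orders
        ≡⟨ *-comm (n * n) (length orders) ⟩
      length orders * (n * n) ∎
      where open ≤-Reasoning

    expectation-counts : ∀ {μ ν} → IsMaxMatchingSize G μ → IsMinVertexCoverSize G ν → ∃₂ λ k B →
      expectedM1 G s ≡ ℤ.+ ∑ M1size orders / suc k × ∑ M1size orders ≤ suc k * μ ×
      suc k * ν ≤ 2 * ∑ M1size orders + B × suc s * B ≤ suc k * (n * n)
    expectation-counts maxμ minν =
      length rest , leaders , average-map M1size orders #orders ,
      subst (λ N → ∑ M1size orders ≤ N * _) #orders (∑M1size≤ maxμ) ,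
      subst (λ N → N * _ ≤ 2 * ∑ M1size orders + leaders) #orders (≤∑M1size minν) ,
      subst (λ N → suc s * leaders ≤ N * (n * n)) #orders leaders-bound
      where
      rest : List (List Edge)
      rest = proj₁ (proj₂ (orderings-nonEmpty edges))
      #orders : length orders ≡ suc (length rest)
      #orders = cong length (proj₂ (proj₂ (orderings-nonEmpty edges)))

  -- Rational arithmetic

  -- i / 1 is normalised through gcd, so identities about it are proved in ℚᵘ and transported back.
  ι : ℤ → ℚ
  ι i = i / 1

  ι≃ : ∀ i → ℚ.toℚᵘ (ι i) ℚᵘ.≃ ℚᵘ.mkℚᵘ i 0
  ι≃ i = ℚ.toℚᵘ-fromℚᵘ (ℚᵘ.mkℚᵘ i 0)

  ι-+ : ∀ i j → ι (i ℤ.+ j) ≡ ι i ℚ.+ ι j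
  ι-+ i j = ℚ.toℚᵘ-injective (ℚᵘ.≃-trans (ι≃ (i ℤ.+ j)) (ℚᵘ.≃-trans unnormalised
    (ℚᵘ.≃-sym (ℚᵘ.≃-trans (ℚ.toℚᵘ-homo-+ (ι i) (ι j)) (ℚᵘ.+-cong (ι≃ i) (ι≃ j))))))
    where
    unnormalised : ℚᵘ.mkℚᵘ (i ℤ.+ j) 0 ℚᵘ.≃ ℚᵘ.mkℚᵘ i 0 ℚᵘ.+ ℚᵘ.mkℚᵘ j 0
    unnormalised = ℚᵘ.*≡* (cong₂ (λ a b → (a ℤ.+ b) ℤ.* ℤ.+ 1) (sym (ℤ.*-identityʳ i)) (sym (ℤ.*-identityʳ j)))

  ι-* : ∀ i j → ι (i ℤ.* j) ≡ ι i ℚ.* ι j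
  ι-* i j = ℚ.toℚᵘ-injective (ℚᵘ.≃-trans (ι≃ (i ℤ.* j)) (ℚᵘ.≃-trans (ℚᵘ.*≡* refl)
    (ℚᵘ.≃-sym (ℚᵘ.≃-trans (ℚ.toℚᵘ-homo-* (ι i) (ι j)) (ℚᵘ.*-cong (ι≃ i) (ι≃ j))))))

  ι-neg : ∀ i → ι (ℤ.- i) ≡ ℚ.- ι i
  ι-neg i = ℚ.toℚᵘ-injective (ℚᵘ.≃-trans (ι≃ (ℤ.- i))
    (ℚᵘ.≃-sym (ℚᵘ.≃-trans (ℚ.toℚᵘ-homo‿- (ι i)) (ℚᵘ.-‿cong (ι≃ i)))))

  ι-mono : ∀ {i j} → i ℤ.≤ j → ι i ℚ.≤ ι j
  ι-mono {i} {j} i≤j = ℚ.toℚᵘ-cancel-≤ (ℚᵘ.≤-respˡ-≃ (ℚᵘ.≃-sym (ι≃ i)) (ℚᵘ.≤-respʳ-≃ (ℚᵘ.≃-sym (ι≃ j))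
    (ℚᵘ.*≤* (subst₂ ℤ._≤_ (sym (ℤ.*-identityʳ i)) (sym (ℤ.*-identityʳ j)) i≤j))))

  ι-floor≤ : ∀ q → ι (ℚ.floor q) ℚ.≤ q
  ι-floor≤ q@(ℚ.mkℚ m d _) = ℚ.toℚᵘ-cancel-≤ (ℚᵘ.≤-respˡ-≃ (ℚᵘ.≃-sym (ι≃ (ℚ.floor q)))
    (ℚᵘ.*≤* (ℤ.≤-trans (ℤ.[n/d]*d≤n m (ℤ.+ suc d)) (ℤ.≤-reflexive (sym (ℤ.*-identityʳ m))))))

  ≤ι-ceiling : ∀ q → q ℚ.≤ ι (ℚ.ceiling q)
  ≤ι-ceiling q@(ℚ.mkℚ _ _ _) =
    subst₂ ℚ._≤_ (solve 1 (λ p → :- (:- p) := p) refl q) (sym (ι-neg (ℚ.floor (ℚ.- q)))) (ℚ.neg-antimono-≤ (ι-floor≤ (ℚ.- q)))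

  ⟦_⟧ : ℕ → ℚ
  ⟦ a ⟧ = ι (ℤ.+ a)

  ⟦+⟧ : ∀ a b → ⟦ a + b ⟧ ≡ ⟦ a ⟧ ℚ.+ ⟦ b ⟧
  ⟦+⟧ a b = ι-+ (ℤ.+ a) (ℤ.+ b)

  ⟦*⟧ : ∀ a b → ⟦ a * b ⟧ ≡ ⟦ a ⟧ ℚ.* ⟦ b ⟧
  ⟦*⟧ a b = trans (cong ι (ℤ.pos-* a b)) (ι-* (ℤ.+ a) (ℤ.+ b))

  ⟦≤⟧ : ∀ {a b} → a ≤ b → ⟦ a ⟧ ℚ.≤ ⟦ b ⟧
  ⟦≤⟧ a≤b = ι-mono (ℤ.+≤+ a≤b)

  ⟦⟧-nonNeg : ∀ a → ℚ.NonNegative ⟦ a ⟧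
  ⟦⟧-nonNeg a = ℚ.nonNegative (⟦≤⟧ {0} {a} z≤n)

  ⟦suc⟧-pos : ∀ k → ℚ.Positive ⟦ suc k ⟧
  ⟦suc⟧-pos k = ℚ.normalize-pos (suc k) 1

  ⟦suc⟧-cancel : ∀ k {p q} → ⟦ suc k ⟧ ℚ.* p ℚ.≤ ⟦ suc k ⟧ ℚ.* q → p ℚ.≤ q
  ⟦suc⟧-cancel k = ℚ.*-cancelˡ-≤-pos ⟦ suc k ⟧ {{⟦suc⟧-pos k}}

  ⟦suc⟧*mean : ∀ t k → ⟦ suc k ⟧ ℚ.* (ℤ.+ t / suc k) ≡ ⟦ t ⟧
  ⟦suc⟧*mean t k = ℚ.toℚᵘ-injective (ℚᵘ.≃-trans (ℚ.toℚᵘ-homo-* ⟦ suc k ⟧ (ℤ.+ t / suc k))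
    (ℚᵘ.≃-trans (ℚᵘ.*-cong (ι≃ (ℤ.+ suc k)) (ℚ.toℚᵘ-fromℚᵘ (ℚᵘ.mkℚᵘ (ℤ.+ t) k))) (ℚᵘ.≃-trans cancelled (ℚᵘ.≃-sym (ι≃ (ℤ.+ t))))))
    where
    cancelled : ℚᵘ.mkℚᵘ (ℤ.+ suc k) 0 ℚᵘ.* ℚᵘ.mkℚᵘ (ℤ.+ t) k ℚᵘ.≃ ℚᵘ.mkℚᵘ (ℤ.+ t) 0
    cancelled = ℚᵘ.*≡* (trans (ℤ.*-identityʳ _) (trans (ℤ.*-comm (ℤ.+ suc k) (ℤ.+ t))
      (cong (λ z → ℤ.+ t ℤ.* ℤ.+ suc z) (sym (+-identityʳ k)))))

  10n≤εs : ∀ n ε (ε>0 : 0ℚ ℚ.< ε) → ⟦ 10 * n ⟧ ℚ.≤ ε ℚ.* ⟦ sOf n ε ε>0 ⟧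
  10n≤εs n ε ε>0 = subst (ℚ._≤ ε ℚ.* ⟦ sOf n ε ε>0 ⟧) ε*[10n/ε]
    (ℚ.*-monoˡ-≤-nonNeg ε {{ℚ.pos⇒nonNeg ε {{ℚ.positive ε>0}}}}
      (ℚ.≤-trans (≤ι-ceiling q) (ι-mono (i≤+∣i∣ (ℚ.ceiling q)))))
    where
    instance
      ε≢0 : ℚ.NonZero ε
      ε≢0 = ℚ.>-nonZero ε>0
    q : ℚ
    q = ⟦ 10 * n ⟧ ℚ.÷ ε
    ε*[10n/ε] : ε ℚ.* q ≡ ⟦ 10 * n ⟧
    ε*[10n/ε] = trans (solve 3 (λ e x y → e :* (x :* y) := x :* (e :* y)) refl ε ⟦ 10 * n ⟧ (ℚ.1/ ε))
      (trans (cong (⟦ 10 * n ⟧ ℚ.*_) (ℚ.*-inverseʳ ε)) (ℚ.*-identityʳ ⟦ 10 * n ⟧))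
    i≤+∣i∣ : ∀ i → i ℤ.≤ ℤ.+ ℤ.∣ i ∣
    i≤+∣i∣ (ℤ.+ _)    = ℤ.≤-refl
    i≤+∣i∣ ℤ.-[1+ _ ] = ℤ.-≤+

  module _ where
    open ℚ.≤-Reasoning

    mean≤ : ∀ {t k m} → t ≤ suc k * m → ℤ.+ t / suc k ℚ.≤ ⟦ m ⟧
    mean≤ {t} {k} {m} t≤km = ⟦suc⟧-cancel k (begin
      ⟦ suc k ⟧ ℚ.* (ℤ.+ t / suc k)  ≡⟨ ⟦suc⟧*mean t k ⟩
      ⟦ t ⟧                          ≤⟨ ⟦≤⟧ t≤km ⟩
      ⟦ suc k * m ⟧                  ≡⟨ ⟦*⟧ (suc k) m ⟩
      ⟦ suc k ⟧ ℚ.* ⟦ m ⟧            ∎)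

    2*mean≥ : ∀ {ν t B k} δ → suc k * ν ≤ 2 * t + B → ⟦ B ⟧ ℚ.≤ ⟦ suc k ⟧ ℚ.* δ →
             ⟦ ν ⟧ ℚ.- δ ℚ.≤ ⟦ 2 ⟧ ℚ.* (ℤ.+ t / suc k)
    2*mean≥ {ν} {t} {B} {k} δ kν≤2t+B B≤kδ = begin
      ⟦ ν ⟧ ℚ.- δ                  ≤⟨ ℚ.+-monoˡ-≤ (ℚ.- δ) ν≤2E+δ ⟩
      (⟦ 2 ⟧ ℚ.* E ℚ.+ δ) ℚ.- δ    ≡⟨ solve 2 (λ x d → (x :+ d) :- d := x) refl (⟦ 2 ⟧ ℚ.* E) δ ⟩
      ⟦ 2 ⟧ ℚ.* E                  ∎
      where
      E : ℚ
      E = ℤ.+ t / suc k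
      ν≤2E+δ : ⟦ ν ⟧ ℚ.≤ ⟦ 2 ⟧ ℚ.* E ℚ.+ δ
      ν≤2E+δ = ⟦suc⟧-cancel k (begin
        ⟦ suc k ⟧ ℚ.* ⟦ ν ⟧                          ≡⟨ ⟦*⟧ (suc k) ν ⟨
        ⟦ suc k * ν ⟧                                ≤⟨ ⟦≤⟧ kν≤2t+B ⟩
        ⟦ 2 * t + B ⟧                                ≡⟨ trans (⟦+⟧ (2 * t) B) (cong (ℚ._+ ⟦ B ⟧) (⟦*⟧ 2 t)) ⟩
        ⟦ 2 ⟧ ℚ.* ⟦ t ⟧ ℚ.+ ⟦ B ⟧                    ≤⟨ ℚ.+-monoʳ-≤ (⟦ 2 ⟧ ℚ.* ⟦ t ⟧) B≤kδ ⟩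
        ⟦ 2 ⟧ ℚ.* ⟦ t ⟧ ℚ.+ ⟦ suc k ⟧ ℚ.* δ          ≡⟨ cong (λ x → ⟦ 2 ⟧ ℚ.* x ℚ.+ ⟦ suc k ⟧ ℚ.* δ) (⟦suc⟧*mean t k) ⟨
        ⟦ 2 ⟧ ℚ.* (⟦ suc k ⟧ ℚ.* E) ℚ.+ ⟦ suc k ⟧ ℚ.* δ
          ≡⟨ solve 4 (λ two a x d → two :* (a :* x) :+ a :* d := a :* (two :* x :+ d)) refl ⟦ 2 ⟧ ⟦ suc k ⟧ E δ ⟩
        ⟦ suc k ⟧ ℚ.* (⟦ 2 ⟧ ℚ.* E ℚ.+ δ)            ∎)

    -- With δ = εn/10 and s ≥ 10n/ε we get n² ≤ (s + 1) δ, so the bound on B turns into B ≤ N δ.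
    leaders≤Nδ : ∀ {n s B k} ε → 0ℚ ℚ.< ε → ⟦ 10 * n ⟧ ℚ.≤ ε ℚ.* ⟦ s ⟧ → suc s * B ≤ suc k * (n * n) →
                    ⟦ B ⟧ ℚ.≤ ⟦ suc k ⟧ ℚ.* ((ε ℚ.* ⟦ n ⟧) ℚ.* (ℤ.+ 1 / 10))
    leaders≤Nδ {n} {s} {B} {k} ε ε>0 10n≤εs sB≤kn² = ⟦suc⟧-cancel s (begin
      ⟦ suc s ⟧ ℚ.* ⟦ B ⟧                     ≡⟨ ⟦*⟧ (suc s) B ⟨
      ⟦ suc s * B ⟧                           ≤⟨ ⟦≤⟧ sB≤kn² ⟩
      ⟦ suc k * (n * n) ⟧                     ≡⟨ trans (⟦*⟧ (suc k) (n * n)) (cong (⟦ suc k ⟧ ℚ.*_) (⟦*⟧ n n)) ⟩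
      ⟦ suc k ⟧ ℚ.* (⟦ n ⟧ ℚ.* ⟦ n ⟧)          ≤⟨ ℚ.*-monoˡ-≤-nonNeg ⟦ suc k ⟧ {{⟦⟧-nonNeg (suc k)}} n²≤sδ ⟩
      ⟦ suc k ⟧ ℚ.* (⟦ suc s ⟧ ℚ.* δ)         ≡⟨ solve 3 (λ a b d → a :* (b :* d) := b :* (a :* d)) refl ⟦ suc k ⟧ ⟦ suc s ⟧ δ ⟩
      ⟦ suc s ⟧ ℚ.* (⟦ suc k ⟧ ℚ.* δ)         ∎)
      where
      δ : ℚ
      δ = (ε ℚ.* ⟦ n ⟧) ℚ.* (ℤ.+ 1 / 10)
      n²≤sδ : ⟦ n ⟧ ℚ.* ⟦ n ⟧ ℚ.≤ ⟦ suc s ⟧ ℚ.* δ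
      n²≤sδ = begin
        ⟦ n ⟧ ℚ.* ⟦ n ⟧
          ≡⟨ solve 1 (λ x → x :* x := x :* (con ⟦ 10 ⟧ :* x) :* con (ℤ.+ 1 / 10)) refl ⟦ n ⟧ ⟩
        ⟦ n ⟧ ℚ.* (⟦ 10 ⟧ ℚ.* ⟦ n ⟧) ℚ.* (ℤ.+ 1 / 10)
          ≡⟨ cong (λ x → ⟦ n ⟧ ℚ.* x ℚ.* (ℤ.+ 1 / 10)) (⟦*⟧ 10 n) ⟨
        ⟦ n ⟧ ℚ.* ⟦ 10 * n ⟧ ℚ.* (ℤ.+ 1 / 10)
          ≤⟨ ℚ.*-monoʳ-≤-nonNeg (ℤ.+ 1 / 10) (ℚ.*-monoˡ-≤-nonNeg ⟦ n ⟧ {{⟦⟧-nonNeg n}}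
               (ℚ.≤-trans 10n≤εs (ℚ.*-monoˡ-≤-nonNeg ε {{ℚ.pos⇒nonNeg ε {{ℚ.positive ε>0}}}} (⟦≤⟧ (n≤1+n s))))) ⟩
        ⟦ n ⟧ ℚ.* (ε ℚ.* ⟦ suc s ⟧) ℚ.* (ℤ.+ 1 / 10)
          ≡⟨ solve 3 (λ x e a → x :* (e :* a) :* con (ℤ.+ 1 / 10) := a :* ((e :* x) :* con (ℤ.+ 1 / 10))) refl ⟦ n ⟧ ε ⟦ suc s ⟧ ⟩
        ⟦ suc s ⟧ ℚ.* δ ∎

    ½-bound : ∀ {a b x E} → a ℚ.≤ b → b ℚ.- x ℚ.* (ℤ.+ 1 / 10) ℚ.≤ ⟦ 2 ⟧ ℚ.* E →
            ½ ℚ.* a ℚ.- x ℚ.* (ℤ.+ 1 / 20) ℚ.≤ E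
    ½-bound {a} {b} {x} {E} a≤b b-x/10≤2E = begin
      ½ ℚ.* a ℚ.- x ℚ.* (ℤ.+ 1 / 20)               ≤⟨ ℚ.+-monoˡ-≤ (ℚ.- (x ℚ.* (ℤ.+ 1 / 20))) (ℚ.*-monoˡ-≤-nonNeg ½ a≤b) ⟩
      ½ ℚ.* b ℚ.- x ℚ.* (ℤ.+ 1 / 20)
        ≡⟨ solve 2 (λ b x → con ½ :* b :- x :* con (ℤ.+ 1 / 20) := con ½ :* (b :- x :* con (ℤ.+ 1 / 10))) refl b x ⟩
      ½ ℚ.* (b ℚ.- x ℚ.* (ℤ.+ 1 / 10))             ≤⟨ ℚ.*-monoˡ-≤-nonNeg ½ b-x/10≤2E ⟩
      ½ ℚ.* (⟦ 2 ⟧ ℚ.* E)                           ≡⟨ solve 1 (λ E → con ½ :* (con ⟦ 2 ⟧ :* E) := E) refl E ⟩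
      E                                             ∎

  bounds-from-counts : ∀ {n μ ν t B s k E} ε → 0ℚ ℚ.< ε → ⟦ 10 * n ⟧ ℚ.≤ ε ℚ.* ⟦ s ⟧ → E ≡ ℤ.+ t / suc k →
    t ≤ suc k * μ → μ ≤ ν → suc k * ν ≤ 2 * t + B → suc s * B ≤ suc k * (n * n) →
    ((½ ℚ.* ⟦ μ ⟧ ℚ.- (ε ℚ.* ⟦ n ⟧) ℚ.* (ℤ.+ 1 / 20) ℚ.≤ E) × (E ℚ.≤ ⟦ μ ⟧)) ×
    ((⟦ ν ⟧ ℚ.- (ε ℚ.* ⟦ n ⟧) ℚ.* (ℤ.+ 1 / 10) ℚ.≤ ⟦ 2 ⟧ ℚ.* E) × (⟦ 2 ⟧ ℚ.* E ℚ.≤ ⟦ 2 ⟧ ℚ.* ⟦ ν ⟧))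
  bounds-from-counts {n} {μ} {ν} {t} {B} {s} {k} ε ε>0 10n≤εs refl t≤kμ μ≤ν kν≤2t+B sB≤kn² =
    (½-bound {⟦ μ ⟧} {⟦ ν ⟧} {ε ℚ.* ⟦ n ⟧} (⟦≤⟧ μ≤ν) ν-δ≤2E , E≤μ) , (ν-δ≤2E , ℚ.*-monoˡ-≤-nonNeg ⟦ 2 ⟧ (ℚ.≤-trans E≤μ (⟦≤⟧ μ≤ν)))
    where
    E≤μ : ℤ.+ t / suc k ℚ.≤ ⟦ μ ⟧
    E≤μ = mean≤ t≤kμ
    ν-δ≤2E : ⟦ ν ⟧ ℚ.- (ε ℚ.* ⟦ n ⟧) ℚ.* (ℤ.+ 1 / 10) ℚ.≤ ⟦ 2 ⟧ ℚ.* (ℤ.+ t / suc k)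
    ν-δ≤2E = 2*mean≥ {ν} {t} {B} {k} _ kν≤2t+B (leaders≤Nδ {n} {s} {B} {k} ε ε>0 10n≤εs sB≤kn²)

open import Data.Nat using (ℕ)
open import Data.Product using (_×_; _,_)
open import Data.Integer using (+_)
open import Data.Rational using (ℚ; 0ℚ; _<_; _≤_; _+_; _-_; _*_; _/_; ½)

claim5p3 : (n : ℕ) (G : Graph n) (ε : ℚ) (ε>0 : 0ℚ < ε) (μ ν : ℕ) →
    IsMaxMatchingSize G μ → IsMinVertexCoverSize G ν →
    let E = expectedM1 G (sOf n ε ε>0) in
    ((½ * (+ μ / 1) - (ε * (+ n / 1)) * (+ 1 / 20) ≤ E) × (E ≤ + μ / 1)) ×
    ((+ ν / 1 - (ε * (+ n / 1)) * (+ 1 / 10) ≤ (+ 2 / 1) * E) × ((+ 2 / 1) * E ≤ (+ 2 / 1) * (+ ν / 1)))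
claim5p3 n G ε ε>0 μ ν maxμ minν =
  let k , B , E≡ , t≤kμ , kν≤2t+B , sB≤kn² = H.expectation-counts G s maxμ minν in
  bounds-from-counts {n} {μ} {ν} {∑ M1size (H.orders G s)} {B} {s} {k}
    ε ε>0 (10n≤εs n ε ε>0) E≡ t≤kμ (μ≤ν G maxμ minν) kν≤2t+B sB≤kn²
  where
  s = sOf n ε ε>0
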